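{- For $n\geq 2$, the number of permutations $\pi\in\mathcal{S}_n$ with at most one descent such that $\operatorname{des}(\pi^3)=0$ (i.e. $\pi^3$ is the identity) equals \[\binom{\lfloor\frac{n}{3}\rfloor+3}{3}+\binom{\lfloor\frac{n-1}{3}\rfloor+3}{3}+\binom{\lfloor\frac{n-2}{3}\rfloor+3}{3}-n,\] which equals $\frac12(k^3+4k^2-k+2)$ if $n=3k$, $\frac12(k^3+5k^2+2k+2)$ if $n=3k+1$, and $\frac12(k^3+6k^2+5k+2)$ if $n=3k+2$.
   Context: $\mathcal{S}_n$ is the symmetric group on $[n]$; a permutation $\pi=\pi_1\cdots\pi_n$ (one-line notation) has a descent at $i\in[n-1]$ if $\pi_i>\pi_{i+1}$, and $\operatorname{des}(\pi)$ is the number of descents. $\pi^3=\pi\circ\pi\circ\pi$. -}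

module Defs where

open import Data.Nat using (ℕ; zero; suc; _+_; _*_; _∸_; _<ᵇ_; _≡ᵇ_; _/_)
open import Data.Nat.Combinatorics using (_C_)
open import Data.Bool using (Bool; true; false; _∧_; not; if_then_else_)
open import Data.Fin using (Fin; toℕ)
open import Data.Vec using (Vec; []; _∷_; lookup; tabulate; allFin)
open import Data.List using (List; []; _∷_; concatMap; map; filter; length)
open import Relation.Nullary.Decidable using (T?)

-- A word of length n over [n] = Fin n, written in one-line notation:
-- the i-th entry is π(i).
Word : ℕ → Set
Word n = Vec (Fin n) n

words : {A : Set} → List A → (m : ℕ) → List (Vec A m)
words xs zero    = [] ∷ []
words xs (suc m) = concatMap (λ x → map (x ∷_) (words xs m)) xs

finList : (n : ℕ) → List (Fin n)
finList n = Data.Vec.toList (allFin n)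

allL : {A : Set} → (A → Bool) → List A → Bool
allL p []       = true
allL p (x ∷ xs) = p x ∧ allL p xs

_=ᶠ_ : {n : ℕ} → Fin n → Fin n → Bool
i =ᶠ j = toℕ i ≡ᵇ toℕ j

-- w is a permutation: injective (hence bijective on the finite set [n])
isPerm : {n : ℕ} → Word n → Bool
isPerm {n} w = allL (λ i → allL (λ j → not (lookup w i =ᶠ lookup w j) Data.Bool.∨ (i =ᶠ j)) (finList n)) (finList n)

_∘ₚ_ : {n : ℕ} → Word n → Word n → Word n
π ∘ₚ σ = tabulate (λ i → lookup π (lookup σ i))

cube : {n : ℕ} → Word n → Word n
cube π = π ∘ₚ (π ∘ₚ π)

desList : {A : Set} → (A → ℕ) → List A → ℕ
desList f []            = 0
desList f (x ∷ [])      = 0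
desList f (x ∷ y ∷ xs)  = (if f y <ᵇ f x then 1 else 0) + desList f (y ∷ xs)

des : {n : ℕ} → Word n → ℕ
des w = desList toℕ (Data.Vec.toList w)

perms : (n : ℕ) → List (Word n)
perms n = filter (λ w → T? (isPerm w)) (words (finList n) n)

good : {n : ℕ} → Word n → Bool
good π = (des π <ᵇ 2) ∧ (des (cube π) ≡ᵇ 0)

count : ℕ → ℕ
count n = length (filter (λ π → T? (good π)) (perms n))

module Submission where

-- A permutation π of [n] with π³ = id and at most one descent, say at j, increases on [0, j) and on
-- [j, n).  Fixed points at either end can be split off, so assume π 0 ≠ 0 and π (n - 1) ≠ n - 1.
-- Then π moves every x < j up and every x ≥ j down, so no 3-cycle stays on one side of j.  Cutting
-- [0, j) where π and π² cross j, and [j, n) likewise, gives blocks A₁ A₂ A₃ | B₁ B₂ B₃ with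
-- π : A₁ → A₂ → B₁ → A₁ and A₃ → B₃ → B₂ → A₃.  Since π increases on every block, comparing block
-- lengths around the two cycles gives |A₁| = |A₂| = |B₁| = r and |A₃| = |B₂| = |B₃| = s, and π
-- translates each block onto the next.  So π is determined by the number a of leading fixed points
-- and (r, s), with a + 3(r + s) ≤ n, all triples with r = s = 0 giving the identity.  Hence
-- count n = 1 + Σ_{k=1}^{⌊n/3⌋} (k + 1)(n − 3k + 1), and the closed forms are polynomial identities.

open import Defs
open import Data.Nat using (ℕ; _+_; _*_; _∸_; _/_; _^_; _≤_)
open import Data.Nat.Combinatorics using (_C_)
open import Data.Product using (_×_)
open import Relation.Binary.PropositionalEquality using (_≡_)

open import Data.Bool using (Bool; true; false; T; not; _∨_; if_then_else_)
open import Data.Bool.Properties using (T-∧)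
open import Data.Fin using (Fin; toℕ; fromℕ<) renaming (zero to fzero; suc to fsuc)
open import Data.Fin.Properties using (toℕ-injective; toℕ<n; toℕ-fromℕ<)
open import Data.List using (List; []; _∷_; map; concatMap; cartesianProductWith; _++_; length; filter; upTo)
import Data.List as List
import Data.List.Relation.Unary.All as All
import Data.List.Relation.Unary.AllPairs as AllPairs
open import Data.List.Membership.Propositional using (_∈_)
open import Data.List.Membership.Propositional.Properties
  using (∈-cartesianProductWith⁺; ∈-cartesianProductWith⁻; ∈-upTo⁺; ∈-upTo⁻; ∈-++⁺ˡ; ∈-++⁺ʳ; ∈-++⁻;
         ∈-filter⁺; ∈-filter⁻; ∈-map⁺; ∈-map⁻)
open import Data.List.Membership.Propositional.Properties.WithK using (unique∧set⇒bag)
open import Data.List.Properties using (length-++; length-map; length-upTo)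
open import Data.List.Relation.Binary.BagAndSetEquality using (∼bag⇒↭)
open import Data.List.Relation.Binary.Permutation.Propositional using (_↭_)
open import Data.List.Relation.Binary.Permutation.Propositional.Properties using (↭-length)
open import Data.List.Relation.Unary.Any using (here; there)
open import Data.List.Relation.Unary.Unique.Propositional using (Unique)
import Data.List.Relation.Unary.Unique.Propositional.Properties as Uniqueₚ
open import Data.Nat
open import Data.Nat.Combinatorics using (nCk+nC[k+1]≡[n+1]C[k+1]; nC1≡n)
open import Data.Nat.DivMod using (+-distrib-/-∣ˡ; m*n/n≡m; /-congˡ; m<n⇒m/n≡0)
open import Data.Nat.Divisibility using (m∣m*n)
open import Data.Nat.Properties
open import Data.Nat.Tactic.RingSolver using (solve; solve-∀)
open import Data.Product using (∃; ∃₂; _,_; proj₁; proj₂; uncurry)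
open import Data.Sum using (_⊎_; inj₁; inj₂; [_,_]′)
open import Data.Unit using (tt)
open import Data.Vec as Vec using (Vec; lookup; tabulate; toList)
open import Data.Vec.Membership.Propositional.Properties using (∈-toList⁺; ∈-allFin⁺)
open import Data.Vec.Properties using (∷-injective; lookup∘tabulate)
open import Function using (_∘_; id)
open import Function.Bundles using (Equivalence; mk⇔)
open import Relation.Binary.PropositionalEquality
open import Relation.Nullary using (¬_; yes; no; contradiction)
open import Relation.Nullary.Decidable using (T?; toSum)
open import Relation.Unary using (Decidable)

-- Maps on initial segments and intervals of ℕ

Agree : ℕ → (ℕ → ℕ) → (ℕ → ℕ) → Set
Agree n f g = ∀ {i} → i < n → f i ≡ g i

FixesFrom : ℕ → (ℕ → ℕ) → Set
FixesFrom N f = ∀ {u} → N ≤ u → f u ≡ u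

InjectiveBelow : ℕ → (ℕ → ℕ) → Set
InjectiveBelow n f = ∀ {x y} → x < n → y < n → f x ≡ f y → x ≡ y

IncreasingOn : (ℕ → ℕ) → ℕ → ℕ → Set
IncreasingOn f a b = ∀ {x y} → a ≤ x → x < y → y < b → f x < f y

MapsInto : (ℕ → ℕ) → ℕ → ℕ → ℕ → ℕ → Set
MapsInto f a b c d = ∀ {x} → a ≤ x → x < b → c ≤ f x × f x < d

Ascending : (ℕ → ℕ) → ℕ → Set
Ascending f m = ∀ {i} → suc i < m → f i ≤ f (suc i)

AscendingExcept : ℕ → (ℕ → ℕ) → ℕ → Set
AscendingExcept j f m = ∀ {i} → suc i < m → suc i ≢ j → f i ≤ f (suc i)

Affine : (ℕ → ℕ) → ℕ → ℕ → ℕ → Set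
Affine f a b c = ∀ {k} → a + k < b → f (a + k) ≡ c + k

order3⇒injective : ∀ {f : ℕ → ℕ} → f ∘ f ∘ f ≗ id → ∀ {x y} → f x ≡ f y → x ≡ y
order3⇒injective {f} f³≗id {x} {y} fx≡fy = trans (sym (f³≗id x)) (trans (cong (f ∘ f) fx≡fy) (f³≗id y))

order3∧fixesFrom⇒below : ∀ {f N} → f ∘ f ∘ f ≗ id → FixesFrom N f → ∀ {u} → u < N → f u < N
order3∧fixesFrom⇒below {f} {N} f³≗id fix {u} u<N with f u <? N
... | yes fu<N = fu<N
... | no fu≮N = contradiction u<N (≤⇒≯ (subst (N ≤_) fu≡u N≤fu))
  where
  N≤fu : N ≤ f u
  N≤fu = ≮⇒≥ fu≮N
  fu≡u : f u ≡ u
  fu≡u = trans (sym (trans (cong f (fix N≤fu)) (fix N≤fu))) (f³≗id u)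

ascending⇒increasingOn : ∀ {f a b} → (∀ {i} → a ≤ i → suc i < b → f i < f (suc i)) → IncreasingOn f a b
ascending⇒increasingOn {f} {a} {b} asc {x} a≤x = go
  where
  go : ∀ {y} → x < y → y < b → f x < f y
  go {suc y} (s≤s x≤y) y+1<b with m≤n⇒m<n∨m≡n x≤y
  ... | inj₁ x<y  = <-trans (go x<y (<-trans (n<1+n y) y+1<b)) (asc (≤-trans a≤x (<⇒≤ x<y)) y+1<b)
  ... | inj₂ refl = asc a≤x y+1<b

increasingOn-mono : ∀ {f a b a′ b′} → a ≤ a′ → b′ ≤ b → IncreasingOn f a b → IncreasingOn f a′ b′
increasingOn-mono a≤a′ b′≤b inc a′≤x x<y y<b′ = inc (≤-trans a≤a′ a′≤x) x<y (<-≤-trans y<b′ b′≤b)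

increasing-gap : ∀ {f a b} → IncreasingOn f a b → ∀ {x} k → a ≤ x → x + k < b → f x + k ≤ f (x + k)
increasing-gap {f} inc {x} zero _ _ = ≤-reflexive (trans (+-identityʳ (f x)) (cong f (sym (+-identityʳ x))))
increasing-gap {f} {b = b} inc {x} (suc k) a≤x x+[k+1]<b = begin
  f x + suc k      ≡⟨ +-suc (f x) k ⟩
  suc (f x + k)    ≤⟨ s≤s (increasing-gap inc k a≤x (<-trans (n<1+n (x + k)) x+k+1<b)) ⟩
  suc (f (x + k))  ≤⟨ inc (≤-trans a≤x (m≤m+n x k)) (n<1+n (x + k)) x+k+1<b ⟩
  f (suc (x + k))  ≡⟨ cong f (+-suc x k) ⟨
  f (x + suc k)    ∎
  where
  open ≤-Reasoning
  x+k+1<b : suc (x + k) < b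
  x+k+1<b = subst (_< b) (+-suc x k) x+[k+1]<b

module _ {f a b c d} (inc : IncreasingOn f a b) (into : MapsInto f a b c d) where

  private
    shifted-bound : ∀ {k} → a + k < b → c + k < d
    shifted-bound {k} a+k<b = ≤-<-trans
      (≤-trans (+-monoˡ-≤ k (proj₁ (into ≤-refl (≤-<-trans (m≤m+n a k) a+k<b)))) (increasing-gap inc k ≤-refl a+k<b))
      (proj₂ (into (m≤m+n a k) a+k<b))

  increasing-length≤ : b ∸ a ≤ d ∸ c
  increasing-length≤ with a <? b
  ... | no a≮b = subst (_≤ d ∸ c) (sym (m≤n⇒m∸n≡0 (≮⇒≥ a≮b))) z≤n
  ... | yes a<b with m≤n⇒∃[o]m+o≡n a<b
  ...   | e , refl = begin
    suc (a + e) ∸ a  ≡⟨ cong (_∸ a) (+-suc a e) ⟨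
    a + suc e ∸ a    ≡⟨ m+n∸m≡n a (suc e) ⟩
    suc e            ≤⟨ m+n≤o⇒m≤o∸n (suc e) (subst (_≤ d) (cong suc (+-comm c e)) (shifted-bound (n<1+n (a + e)))) ⟩
    d ∸ c            ∎
    where open ≤-Reasoning

  increasing-affine : b ∸ a ≡ d ∸ c → Affine f a b c
  increasing-affine len {k} a+k<b with m≤n⇒∃[o]m+o≡n a+k<b
  ... | e , refl = ≤-antisym (+-cancelʳ-≤ (suc e) (f (a + k)) (c + k) upper) lower
    where
    fa-bounds : c ≤ f a × f a < d
    fa-bounds = into ≤-refl (≤-<-trans (m≤m+n a k) a+k<b)
    lower : c + k ≤ f (a + k)
    lower = ≤-trans (+-monoˡ-≤ k (proj₁ fa-bounds)) (increasing-gap inc k ≤-refl a+k<b)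
    d≡ : d ≡ c + k + suc e
    d≡ = begin
      d                          ≡⟨ m+[n∸m]≡n (<⇒≤ (≤-<-trans (proj₁ fa-bounds) (proj₂ fa-bounds))) ⟨
      c + (d ∸ c)                ≡⟨ cong (c +_) len ⟨
      c + (suc (a + k) + e ∸ a)  ≡⟨ cong (λ x → c + (x ∸ a)) (solve (a ∷ k ∷ e ∷ [])) ⟩
      c + (a + (k + suc e) ∸ a)  ≡⟨ cong (c +_) (m+n∸m≡n a (k + suc e)) ⟩
      c + (k + suc e)            ≡⟨ +-assoc c k (suc e) ⟨
      c + k + suc e              ∎
      where open ≡-Reasoning
    upper : f (a + k) + suc e ≤ c + k + suc e
    upper = begin
      f (a + k) + suc e    ≡⟨ +-suc (f (a + k)) e ⟩
      suc (f (a + k) + e)  ≤⟨ s≤s (increasing-gap inc e (m≤m+n a k) ≤-refl) ⟩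
      suc (f (a + k + e))  ≤⟨ proj₂ (into (≤-trans (m≤m+n a k) (m≤m+n (a + k) e)) ≤-refl) ⟩
      d                    ≡⟨ d≡ ⟩
      c + k + suc e        ∎
      where open ≤-Reasoning

increasing-endo⇒id : ∀ {f n} → IncreasingOn f 0 n → (∀ {x} → x < n → f x < n) → Agree n f id
increasing-endo⇒id inc below = increasing-affine inc (λ _ x<n → z≤n , below x<n) refl

ascending∧injective⇒increasing : ∀ {f n} → Ascending f n → InjectiveBelow n f → IncreasingOn f 0 n
ascending∧injective⇒increasing asc inj = ascending⇒increasingOn λ {i} _ i+1<n →
  ≤∧≢⇒< (asc i+1<n) (λ fi≡fi+1 → <-irrefl (inj (<-trans (n<1+n i) i+1<n) i+1<n fi≡fi+1) (n<1+n i))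

DownClosedOn : (ℕ → Set) → ℕ → ℕ → Set
DownClosedOn Q lo hi = ∀ {x y} → lo ≤ x → x < y → y < hi → Q y → Q x

record Threshold (Q : ℕ → Set) (lo hi : ℕ) : Set where
  field
    point    : ℕ
    lo≤point : lo ≤ point
    point≤hi : point ≤ hi
    below    : ∀ {x} → lo ≤ x → x < point → Q x
    above    : ∀ {x} → point ≤ x → x < hi → ¬ Q x

threshold : ∀ {Q} → Decidable Q → ∀ {lo hi} → lo ≤ hi → DownClosedOn Q lo hi → Threshold Q lo hi
threshold Q? {lo} {hi} lo≤hi closed with m≤n⇒m<n∨m≡n lo≤hi
... | inj₂ refl = record
  { point = lo ; lo≤point = ≤-refl ; point≤hi = ≤-refl
  ; below = λ lo≤x x<lo → contradiction x<lo (≤⇒≯ lo≤x)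
  ; above = λ lo≤x x<lo → contradiction x<lo (≤⇒≯ lo≤x) }
... | inj₁ (s≤s {n = h} lo≤h) with Q? h
...   | yes qh = record
  { point = suc h ; lo≤point = m≤n⇒m≤1+n lo≤h ; point≤hi = ≤-refl
  ; below = λ lo≤x x<h+1 →
      [ (λ x<h → closed lo≤x x<h (n<1+n h) qh) , (λ { refl → qh }) ]′ (m≤n⇒m<n∨m≡n (≤-pred x<h+1))
  ; above = λ h+1≤x x<h+1 → contradiction x<h+1 (≤⇒≯ h+1≤x) }
...   | no ¬qh = record
  { point = point ; lo≤point = lo≤point ; point≤hi = m≤n⇒m≤1+n point≤hi ; below = below
  ; above = λ p≤x x<h+1 → [ above p≤x , (λ { refl → ¬qh }) ]′ (m≤n⇒m<n∨m≡n (≤-pred x<h+1)) }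
  where
  open Threshold (threshold Q? lo≤h (λ lo≤x x<y y<h → closed lo≤x x<y (m<n⇒m<1+n y<h)))

≤-cycle : ∀ {x y z} → x ≤ y → y ≤ z → z ≤ x → x ≡ y × y ≡ z
≤-cycle x≤y y≤z z≤x = ≤-antisym x≤y (≤-trans y≤z z≤x) , ≤-antisym y≤z (≤-trans z≤x x≤y)

∸≡⇒≡+ : ∀ {a b ℓ} → a ≤ b → b ∸ a ≡ ℓ → b ≡ a + ℓ
∸≡⇒≡+ {a} a≤b eq = trans (sym (m+[n∸m]≡n a≤b)) (cong (a +_) eq)

-- The core permutations

gate : ℕ → ℕ → ℕ → ℕ
gate c u x = if u <ᵇ c then 0 else x

gate-< : ∀ {c u} x → u < c → gate c u x ≡ 0
gate-< {c} {u} x u<c with u <ᵇ c | <⇒<ᵇ u<c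
... | true | _ = refl

gate-≥ : ∀ {c u} x → c ≤ u → gate c u x ≡ x
gate-≥ {c} {u} x c≤u with u <ᵇ c | <ᵇ⇒< u c
... | false | _   = refl
... | true  | u<c = contradiction (u<c _) (≤⇒≯ c≤u)

gate-mono : ∀ c u x → gate c u x ≤ gate c (suc u) x
gate-mono c u x with u <? c
... | yes u<c = subst (_≤ gate c (suc u) x) (sym (gate-< x u<c)) z≤n
... | no u≮c  = ≤-reflexive (trans (gate-≥ x (≮⇒≥ u≮c)) (sym (gate-≥ x (m≤n⇒m≤1+n (≮⇒≥ u≮c)))))

-- core r s cuts [0, 3(r + s)) into consecutive blocks A₁ A₂ A₃ B₁ B₂ B₃ of lengths r r s r s s and
-- translates A₁ → A₂ → B₁ → A₁ and A₃ → B₃ → B₂ → A₃; it fixes every point from 3(r + s) on.  Written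
-- as a sum of gates on each of the runs A₁A₂A₃ and B₁B₂B₃ it is visibly increasing on both.

descentAt : ℕ → ℕ → ℕ
descentAt r s = r + r + s

coreSize : ℕ → ℕ → ℕ
coreSize r s = descentAt r s + r + s + s

firstRun : ℕ → ℕ → ℕ → ℕ
firstRun r s u = u + r + gate r u s + gate (r + r) u s

secondRun : ℕ → ℕ → ℕ → ℕ
secondRun r s v = v + gate r v r + gate (r + s) v r + gate (r + s + s) v s

core : ℕ → ℕ → ℕ → ℕ
core r s u = if u <ᵇ descentAt r s then firstRun r s u else secondRun r s (u ∸ descentAt r s)

core-firstRun : ∀ r s {u} → u < descentAt r s → core r s u ≡ firstRun r s u
core-firstRun r s {u} u<t with u <ᵇ descentAt r s | <⇒<ᵇ u<t
... | true | _ = refl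

core-secondRun : ∀ r s v → core r s (descentAt r s + v) ≡ secondRun r s v
core-secondRun r s v with descentAt r s + v <ᵇ descentAt r s | <ᵇ⇒< (descentAt r s + v) (descentAt r s)
... | false | _  = cong (secondRun r s) (m+n∸m≡n (descentAt r s) v)
... | true  | lt = contradiction (lt _) (m+n≮m (descentAt r s) v)

private
  assoc₄ : ∀ a b c x → a + b + c + x ≡ a + (b + c + x)
  assoc₄ = solve-∀
  assoc₅ : ∀ a b c e x → a + b + c + e + x ≡ a + (b + c + e + x)
  assoc₅ = solve-∀

module _ (r s : ℕ) {d : ℕ} where

  core-A₁ : d < r → core r s d ≡ r + d
  core-A₁ d<r
    rewrite core-firstRun r s (m≤n⇒m≤n+o s (m≤n⇒m≤n+o r d<r)) | gate-< s d<r | gate-< s (m≤n⇒m≤n+o r d<r)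
    = solve (d ∷ r ∷ [])

  core-A₂ : d < r → core r s (r + d) ≡ descentAt r s + d
  core-A₂ d<r
    rewrite core-firstRun r s (m≤n⇒m≤n+o s (+-monoʳ-< r d<r)) | gate-≥ s (m≤m+n r d) | gate-< s (+-monoʳ-< r d<r)
    = solve (r ∷ s ∷ d ∷ [])

  core-A₃ : d < s → core r s (r + r + d) ≡ descentAt r s + r + s + d
  core-A₃ d<s
    rewrite core-firstRun r s (+-monoʳ-< (r + r) d<s)
          | gate-≥ s (m≤n⇒m≤n+o d (m≤m+n r r)) | gate-≥ s (m≤m+n (r + r) d)
    = solve (r ∷ s ∷ d ∷ [])

  core-B₁ : d < r → core r s (descentAt r s + d) ≡ d
  core-B₁ d<r
    rewrite core-secondRun r s d
          | gate-< r d<r | gate-< r (m≤n⇒m≤n+o s d<r) | gate-< s (m≤n⇒m≤n+o s (m≤n⇒m≤n+o s d<r))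
    = solve (d ∷ [])

  core-B₂ : d < s → core r s (descentAt r s + r + d) ≡ r + r + d
  core-B₂ d<s
    rewrite +-assoc (descentAt r s) r d | core-secondRun r s (r + d)
          | gate-≥ r (m≤m+n r d) | gate-< r (+-monoʳ-< r d<s) | gate-< s (m≤n⇒m≤n+o s (+-monoʳ-< r d<s))
    = solve (r ∷ d ∷ [])

  core-B₃ : d < s → core r s (descentAt r s + r + s + d) ≡ descentAt r s + r + d
  core-B₃ d<s
    rewrite assoc₄ (descentAt r s) r s d | core-secondRun r s (r + s + d)
          | gate-≥ r (m≤n⇒m≤n+o d (m≤m+n r s)) | gate-≥ r (m≤m+n (r + s) d) | gate-< s (+-monoʳ-< (r + s) d<s)
    = solve (r ∷ s ∷ d ∷ [])

  core-outside : core r s (coreSize r s + d) ≡ coreSize r s + d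
  core-outside
    rewrite assoc₅ (descentAt r s) r s s d | core-secondRun r s (r + s + s + d)
          | gate-≥ r (m≤n⇒m≤n+o d (m≤n⇒m≤n+o s (m≤m+n r s))) | gate-≥ r (m≤n⇒m≤n+o d (m≤m+n (r + s) s))
          | gate-≥ s (m≤m+n (r + s + s) d)
    = solve (r ∷ s ∷ d ∷ [])

data Split (c : ℕ) : ℕ → Set where
  before : ∀ {u} → u < c → Split c u
  after  : ∀ d → Split c (c + d)

split : ∀ c u → Split c u
split zero    u       = after u
split (suc c) zero    = before z<s
split (suc c) (suc u) with split c u
... | before u<c = before (s<s u<c)
... | after d    = after d

data Block (r s : ℕ) : ℕ → Set where
  A₁      : ∀ {d} → d < r → Block r s d
  A₂      : ∀ {d} → d < r → Block r s (r + d)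
  A₃      : ∀ {d} → d < s → Block r s (r + r + d)
  B₁      : ∀ {d} → d < r → Block r s (descentAt r s + d)
  B₂      : ∀ {d} → d < s → Block r s (descentAt r s + r + d)
  B₃      : ∀ {d} → d < s → Block r s (descentAt r s + r + s + d)
  outside : ∀ d → Block r s (coreSize r s + d)

private
  nest₄ : ∀ a b c x → a + b + c + x ≡ a + (b + (c + x))
  nest₄ = solve-∀
  nest₅ : ∀ a b c e x → a + b + c + e + x ≡ a + (b + (c + (e + x)))
  nest₅ = solve-∀
  nest₆ : ∀ a b c e f x → a + b + c + e + f + x ≡ a + (b + (c + (e + (f + x))))
  nest₆ = solve-∀
  nest₇ : ∀ a b c e f g x → a + b + c + e + f + g + x ≡ a + (b + (c + (e + (f + (g + x)))))
  nest₇ = solve-∀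

block : ∀ r s u → Block r s u
block r s u with split r u
... | before d<r = A₁ d<r
... | after u₁ with split r u₁
... | before d<r = A₂ d<r
... | after u₂ with split s u₂
... | before d<s = subst (Block r s) (+-assoc r r _) (A₃ d<s)
... | after u₃ with split r u₃
... | before d<r = subst (Block r s) (nest₄ r r s _) (B₁ d<r)
... | after u₄ with split s u₄
... | before d<s = subst (Block r s) (nest₅ r r s r _) (B₂ d<s)
... | after u₅ with split s u₅
... | before d<s = subst (Block r s) (nest₆ r r s r s _) (B₃ d<s)
... | after u₆   = subst (Block r s) (nest₇ r r s r s s u₆) (outside u₆)

core-cube : ∀ r s → core r s ∘ core r s ∘ core r s ≗ id
core-cube r s u with block r s u
... | A₁ h rewrite core-A₁ r s h | core-A₂ r s h | core-B₁ r s h = refl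
... | A₂ h rewrite core-A₂ r s h | core-B₁ r s h | core-A₁ r s h = refl
... | A₃ h rewrite core-A₃ r s h | core-B₃ r s h | core-B₂ r s h = refl
... | B₁ h rewrite core-B₁ r s h | core-A₁ r s h | core-A₂ r s h = refl
... | B₂ h rewrite core-B₂ r s h | core-A₃ r s h | core-B₃ r s h = refl
... | B₃ h rewrite core-B₃ r s h | core-B₂ r s h | core-A₃ r s h = refl
... | outside d rewrite core-outside r s {d} | core-outside r s {d} | core-outside r s {d} = refl

core-fixesFrom : ∀ r s → FixesFrom (coreSize r s) (core r s)
core-fixesFrom r s N≤u with m≤n⇒∃[o]m+o≡n N≤u
... | d , refl = core-outside r s

core-moves : ∀ r s {u} → u < coreSize r s → core r s u ≢ u
core-moves r s {u} u<N with block r s u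
... | A₁ {d} h rewrite core-A₁ r s h = ≢-sym (<⇒≢ (m<n+m d (m<n⇒0<n h)))
... | A₂ {d} h rewrite core-A₂ r s h =
  ≢-sym (<⇒≢ (<-≤-trans (m≤n⇒m≤n+o s (+-monoʳ-< r h)) (m≤m+n (descentAt r s) d)))
... | A₃ {d} h rewrite core-A₃ r s h =
  ≢-sym (<⇒≢ (<-≤-trans (+-monoʳ-< (r + r) h) (m≤n⇒m≤n+o d (m≤n⇒m≤n+o s (m≤m+n (descentAt r s) r)))))
... | B₁ {d} h rewrite core-B₁ r s h = <⇒≢ (m<n+m d (m≤n⇒m≤n+o s (m≤n⇒m≤n+o r (m<n⇒0<n h))))
... | B₂ {d} h rewrite core-B₂ r s h =
  <⇒≢ (<-≤-trans (+-monoʳ-< (r + r) h) (m≤n⇒m≤n+o d (m≤m+n (descentAt r s) r)))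
... | B₃ {d} h rewrite core-B₃ r s h = <⇒≢ (+-monoˡ-< d (m<m+n (descentAt r s + r) (m<n⇒0<n h)))
... | outside d = contradiction u<N (m+n≮m (coreSize r s) d)

firstRun-< : ∀ r s u → firstRun r s u < firstRun r s (suc u)
firstRun-< r s u = +-mono-<-≤ (+-mono-<-≤ (n<1+n (u + r)) (gate-mono r u s)) (gate-mono (r + r) u s)

secondRun-< : ∀ r s v → secondRun r s v < secondRun r s (suc v)
secondRun-< r s v =
  +-mono-<-≤ (+-mono-<-≤ (+-mono-<-≤ (n<1+n v) (gate-mono r v r)) (gate-mono (r + s) v r)) (gate-mono (r + s + s) v s)

core-ascending : ∀ r s {i} → suc i ≢ descentAt r s → core r s i < core r s (suc i)
core-ascending r s {i} i+1≢t with split (descentAt r s) i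
... | before i<t = begin-strict
  core r s i            ≡⟨ core-firstRun r s i<t ⟩
  firstRun r s i        <⟨ firstRun-< r s i ⟩
  firstRun r s (suc i)  ≡⟨ core-firstRun r s (≤∧≢⇒< i<t i+1≢t) ⟨
  core r s (suc i)      ∎
  where open ≤-Reasoning
... | after v = begin-strict
  core r s (descentAt r s + v)        ≡⟨ core-secondRun r s v ⟩
  secondRun r s v                     <⟨ secondRun-< r s v ⟩
  secondRun r s (suc v)               ≡⟨ core-secondRun r s (suc v) ⟨
  core r s (descentAt r s + suc v)    ≡⟨ cong (core r s) (+-suc (descentAt r s) v) ⟩
  core r s (suc (descentAt r s + v))  ∎
  where open ≤-Reasoning

coreSize≡3*[r+s] : ∀ r s → coreSize r s ≡ 3 * (r + s)
coreSize≡3*[r+s] = expand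
  where
  expand : ∀ r s → r + r + s + r + s + s ≡ 3 * (r + s)
  expand = solve-∀

0<coreSize : ∀ r s → 0 < r + s → 0 < coreSize r s
0<coreSize r s 0<r+s = subst (0 <_) (sym (coreSize≡3*[r+s] r s)) (m<n⇒m<o*n 3 0<r+s)

core-0-when-r≡0 : ∀ {s} → 0 < s → core 0 s 0 ≡ s + s
core-0-when-r≡0 {s} 0<s = trans (core-A₃ 0 s 0<s) (trans (+-identityʳ (s + 0 + s)) (cong (_+ s) (+-identityʳ s)))

core-0-determines-r : ∀ {r s r′ s′} → 0 < r + s → r + s ≡ r′ + s′ → core r s 0 ≡ core r′ s′ 0 → r ≡ r′
core-0-determines-r {zero}  {s} {zero}           _   _     _  = refl
core-0-determines-r {suc r} {s} {suc r′} {s′}    _   _     eq =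
  +-cancelʳ-≡ 0 (suc r) (suc r′) (trans (sym (core-A₁ (suc r) s z<s)) (trans eq (core-A₁ (suc r′) s′ z<s)))
core-0-determines-r {zero}  {s} {suc r′} {s′}    0<s s≡r+s eq = contradiction s+s≤s (<⇒≱ (m<m+n s 0<s))
  where
  open ≤-Reasoning
  s+s≤s : s + s ≤ s
  s+s≤s = begin
    s + s          ≡⟨ core-0-when-r≡0 0<s ⟨
    core 0 s 0     ≡⟨ trans eq (core-A₁ (suc r′) s′ z<s) ⟩
    suc r′ + 0     ≤⟨ +-monoʳ-≤ (suc r′) z≤n ⟩
    suc r′ + s′    ≡⟨ s≡r+s ⟨
    s              ∎
core-0-determines-r {suc r} {s} {zero}  {s′}     0<r+s r+s≡s′ eq =
  sym (core-0-determines-r {zero} {s′} {suc r} {s} (subst (0 <_) r+s≡s′ 0<r+s) (sym r+s≡s′) (sym eq))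

-- Canonical permutations

shift : ℕ → (ℕ → ℕ) → ℕ → ℕ
shift zero    f u       = f u
shift (suc a) f zero    = zero
shift (suc a) f (suc u) = suc (shift a f u)

shift-+ : ∀ a f u → shift a f (a + u) ≡ a + f u
shift-+ zero    f u = refl
shift-+ (suc a) f u = cong suc (shift-+ a f u)

shift-< : ∀ {a} f {i} → i < a → shift a f i ≡ i
shift-< {suc a} f {zero}  _         = refl
shift-< {suc a} f {suc i} (s<s i<a) = cong suc (shift-< f i<a)

shift-id : ∀ a {f} → f ≗ id → shift a f ≗ id
shift-id zero    f≗id u       = f≗id u
shift-id (suc a) f≗id zero    = refl
shift-id (suc a) f≗id (suc u) = cong suc (shift-id a f≗id u)

shift-cube : ∀ a {f} → f ∘ f ∘ f ≗ id → shift a f ∘ shift a f ∘ shift a f ≗ id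
shift-cube zero    f³≗id u       = f³≗id u
shift-cube (suc a) f³≗id zero    = refl
shift-cube (suc a) f³≗id (suc u) = cong suc (shift-cube a f³≗id u)

shift-fixesFrom : ∀ a {f N} → FixesFrom N f → FixesFrom (a + N) (shift a f)
shift-fixesFrom zero    fix N≤u                 = fix N≤u
shift-fixesFrom (suc a) fix {suc u} (s≤s a+N≤u) = cong suc (shift-fixesFrom a fix a+N≤u)

shift-ascending : ∀ a {f c} → (∀ {i} → suc i ≢ c → f i < f (suc i)) →
                  ∀ {i} → suc i ≢ a + c → shift a f i < shift a f (suc i)
shift-ascending zero    asc         i+1≢c = asc i+1≢c
shift-ascending (suc a) asc {zero}  _     = z<s
shift-ascending (suc a) asc {suc i} i+1≢c = s<s (shift-ascending a asc (i+1≢c ∘ cong suc))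

Triple : Set
Triple = ℕ × ℕ × ℕ

canonical : Triple → ℕ → ℕ
canonical (a , r , s) = shift a (core r s)

Fits : ℕ → Triple → Set
Fits n (a , r , s) = a + coreSize r s ≤ n

Nontrivial : Triple → Set
Nontrivial (_ , r , s) = 0 < r + s

canonical-cube : ∀ t → canonical t ∘ canonical t ∘ canonical t ≗ id
canonical-cube (a , r , s) = shift-cube a (core-cube r s)

canonical-fixesFrom : ∀ a r s → FixesFrom (a + coreSize r s) (canonical (a , r , s))
canonical-fixesFrom a r s = shift-fixesFrom a (core-fixesFrom r s)

canonical-below : ∀ {n} t → Fits n t → ∀ {u} → u < n → canonical t u < n
canonical-below t@(a , r , s) fits {u} u<n with u <? a + coreSize r s
... | yes u<N = <-≤-trans (order3∧fixesFrom⇒below (canonical-cube t) (canonical-fixesFrom a r s) u<N) fits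
... | no u≮N  = subst (_< _) (sym (canonical-fixesFrom a r s (≮⇒≥ u≮N))) u<n

canonical-ascending : ∀ a r s {i} → suc i ≢ a + descentAt r s →
                      canonical (a , r , s) i < canonical (a , r , s) (suc i)
canonical-ascending a r s = shift-ascending a (core-ascending r s)

canonical-trivial : ∀ a {r s} → r + s ≡ 0 → canonical (a , r , s) ≗ id
canonical-trivial a {zero}  {zero}  _ = shift-id a (λ _ → core-fixesFrom 0 0 z≤n)
canonical-trivial a {zero}  {suc s} ()
canonical-trivial a {suc r}         ()

canonical-moves-offset : ∀ a r s → 0 < r + s → canonical (a , r , s) a ≢ a
canonical-moves-offset a r s 0<r+s eq = core-moves r s (0<coreSize r s 0<r+s) (+-cancelˡ-≡ a _ _ (begin
  a + core r s 0              ≡⟨ shift-+ a (core r s) 0 ⟨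
  shift a (core r s) (a + 0)  ≡⟨ cong (shift a (core r s)) (+-identityʳ a) ⟩
  shift a (core r s) a        ≡⟨ eq ⟩
  a                           ≡⟨ +-identityʳ a ⟨
  a + 0                       ∎))
  where open ≡-Reasoning

private
  offset-≮ : ∀ {n} a r s {a′} g → 0 < r + s → a + coreSize r s ≤ n →
             Agree n (canonical (a , r , s)) (shift a′ g) → ¬ a < a′
  offset-≮ a r s g 0<r+s fits agree a<a′ = canonical-moves-offset a r s 0<r+s
    (trans (agree (<-≤-trans (m<m+n a (0<coreSize r s 0<r+s)) fits)) (shift-< g a<a′))

  coreSize-≮ : ∀ {n} a r s r′ s′ → a + coreSize r′ s′ ≤ n →
               (∀ {u} → a + u < n → core r s u ≡ core r′ s′ u) → ¬ coreSize r s < coreSize r′ s′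
  coreSize-≮ a r s r′ s′ fits′ agree N<N′ =
    core-moves r′ s′ N<N′ (trans (sym (agree (<-≤-trans (+-monoʳ-< a N<N′) fits′))) (core-fixesFrom r s ≤-refl))

canonical-injective : ∀ {n} t t′ → Nontrivial t → Nontrivial t′ → Fits n t → Fits n t′ →
                      Agree n (canonical t) (canonical t′) → t ≡ t′
canonical-injective {n} (a , r , s) (a′ , r′ , s′) nt nt′ fits fits′ agree
  with ≤-antisym (≮⇒≥ (offset-≮ a′ r′ s′ (core r s) nt′ fits′ (sym ∘ agree)))
                 (≮⇒≥ (offset-≮ a r s (core r′ s′) nt fits agree))
... | refl = cong (a ,_) (cong₂ _,_ r≡r′ (+-cancelˡ-≡ r s s′ (trans r+s≡r′+s′ (cong (_+ s′) (sym r≡r′)))))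
  where
  agreeCore : ∀ {u} → a + u < n → core r s u ≡ core r′ s′ u
  agreeCore {u} a+u<n =
    +-cancelˡ-≡ a _ _ (trans (sym (shift-+ a (core r s) u)) (trans (agree a+u<n) (shift-+ a (core r′ s′) u)))
  N≡N′ : coreSize r s ≡ coreSize r′ s′
  N≡N′ = ≤-antisym (≮⇒≥ (coreSize-≮ a r′ s′ r s fits (sym ∘ agreeCore)))
                   (≮⇒≥ (coreSize-≮ a r s r′ s′ fits′ agreeCore))
  r+s≡r′+s′ : r + s ≡ r′ + s′
  r+s≡r′+s′ = *-cancelˡ-≡ (r + s) (r′ + s′) 3
    (trans (sym (coreSize≡3*[r+s] r s)) (trans N≡N′ (coreSize≡3*[r+s] r′ s′)))
  r≡r′ : r ≡ r′
  r≡r′ = core-0-determines-r nt r+s≡r′+s′ (agreeCore (<-≤-trans (+-monoʳ-< a (0<coreSize r s nt)) fits))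

-- Classification

-- What isPerm π and good π say about p = val π, with j the only place where p may descend.
record Good (n j : ℕ) (p : ℕ → ℕ) : Set where
  field
    p-below : ∀ {x} → x < n → p x < n
    p-cube  : ∀ {x} → x < n → p (p (p x)) ≡ x
    p-asc   : ∀ {i} → suc i < n → suc i ≢ j → p i < p (suc i)

  p-injective : InjectiveBelow n p
  p-injective {x} {y} x<n y<n px≡py = trans (sym (p-cube x<n)) (trans (cong (p ∘ p) px≡py) (p-cube y<n))

blocks⇒core : ∀ {p} r s {a₂ j b₁ b₂ n} →
  a₂ ≡ r + r → j ≡ descentAt r s → b₁ ≡ j + r → b₂ ≡ b₁ + s → n ≡ b₂ + s →
  Affine p 0 r r → Affine p r a₂ j → Affine p a₂ j b₂ →
  Affine p j b₁ 0 → Affine p b₁ b₂ a₂ → Affine p b₂ n b₁ →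
  coreSize r s ≡ n × Agree n p (core r s)
blocks⇒core {p} r s refl refl refl refl refl A₁↦ A₂↦ A₃↦ B₁↦ B₂↦ B₃↦ = refl , agree
  where
  agree : Agree (coreSize r s) p (core r s)
  agree {i} i<n with block r s i
  ... | A₁ h      = trans (A₁↦ h) (sym (core-A₁ r s h))
  ... | A₂ h      = trans (A₂↦ (+-monoʳ-< r h)) (sym (core-A₂ r s h))
  ... | A₃ h      = trans (A₃↦ (+-monoʳ-< (r + r) h)) (sym (core-A₃ r s h))
  ... | B₁ h      = trans (B₁↦ (+-monoʳ-< (descentAt r s) h)) (sym (core-B₁ r s h))
  ... | B₂ h      = trans (B₂↦ (+-monoʳ-< (descentAt r s + r) h)) (sym (core-B₂ r s h))
  ... | B₃ h      = trans (B₃↦ (+-monoʳ-< (descentAt r s + r + s) h)) (sym (core-B₃ r s h))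
  ... | outside d = contradiction i<n (m+n≮m (coreSize r s) d)

module NoFixedEnds {m j : ℕ} {p : ℕ → ℕ} (good : Good (suc m) j p) (p0≢0 : p 0 ≢ 0) (pm≢m : p m ≢ m) where

  open Good good

  private
    n : ℕ
    n = suc m

  0<p0 : 0 < p 0
  0<p0 = ≤∧≢⇒< z≤n (p0≢0 ∘ sym)

  pm<m : p m < m
  pm<m = ≤∧≢⇒< (≤-pred (p-below ≤-refl)) pm≢m

  -- Otherwise p increases on all of [0, n), and p 0 > 0 pushes p m beyond m.
  j≤m : j ≤ m
  j≤m with j ≤? m
  ... | yes j≤m = j≤m
  ... | no j≰m  =
    contradiction (≤-trans (+-monoˡ-≤ m 0<p0) (increasing-gap inc m z≤n ≤-refl)) (<⇒≱ (<-trans pm<m (n<1+n m)))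
    where
    inc : IncreasingOn p 0 n
    inc = ascending⇒increasingOn (λ _ i+1<n → p-asc i+1<n (λ i+1≡j → j≰m (subst (_≤ m) i+1≡j (≤-pred i+1<n))))

  j<n : j < n
  j<n = s≤s j≤m

  incˡ : IncreasingOn p 0 j
  incˡ = ascending⇒increasingOn (λ _ i+1<j → p-asc (<-trans i+1<j j<n) (<⇒≢ i+1<j))

  incʳ : IncreasingOn p j n
  incʳ = ascending⇒increasingOn (λ j≤i i+1<n → p-asc i+1<n (≢-sym (<⇒≢ (s≤s j≤i))))

  x<px : ∀ {x} → x < j → x < p x
  x<px {x} x<j = ≤-trans (+-monoˡ-≤ x 0<p0) (increasing-gap incˡ x z≤n x<j)

  px<x : ∀ {x} → j ≤ x → x < n → p x < x
  px<x {x} j≤x x<n with m≤n⇒∃[o]m+o≡n (≤-pred x<n)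
  ... | k , refl = +-cancelʳ-< k (p x) x (≤-<-trans (increasing-gap incʳ k j≤x ≤-refl) pm<m)

  orbit-meets-right : ∀ {x} → x < j → p x < j → ¬ p (p x) < j
  orbit-meets-right {x} x<j px<j ppx<j = <-irrefl refl
    (<-trans (x<px x<j) (<-trans (x<px px<j) (subst (p (p x) <_) (p-cube (<-trans x<j j<n)) (x<px ppx<j))))

  orbit-meets-left : ∀ {x} → j ≤ x → x < n → j ≤ p x → ¬ j ≤ p (p x)
  orbit-meets-left {x} j≤x x<n j≤px j≤ppx = <-irrefl refl
    (<-trans (subst (_< p (p x)) (p-cube x<n) (px<x j≤ppx (p-below (p-below x<n))))
             (<-trans (px<x j≤px (p-below x<n)) (px<x j≤x x<n)))

  -- The cut points a₁ ≤ a₂ ≤ j ≤ b₁ ≤ b₂ bounding the blocks A₁ = [0, a₁), …, B₃ = [b₂, n): p crosses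
  -- j from a₁ on in [0, j) and from b₂ on in [j, n); p² does so from a₂ on in [a₁, j) and from b₁ on
  -- in [j, b₂).

  private
    T₁ : Threshold (λ x → p x < j) 0 j
    T₁ = threshold (λ x → p x <? j) z≤n (λ 0≤x x<y y<j → <-trans (incˡ 0≤x x<y y<j))

  open Threshold T₁ using ()
    renaming (point to a₁; point≤hi to a₁≤j; below to p<j-below-a₁; above to p≮j-from-a₁)

  private
    T₂ : Threshold (λ x → p (p x) < j) a₁ j
    T₂ = threshold (λ x → p (p x) <? j) a₁≤j λ a₁≤x x<y y<j →
      <-trans (incʳ (≮⇒≥ (p≮j-from-a₁ a₁≤x (<-trans x<y y<j))) (incˡ z≤n x<y y<j) (p-below (<-trans y<j j<n)))

  open Threshold T₂ using ()
    renaming (point to a₂; lo≤point to a₁≤a₂; point≤hi to a₂≤j;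
              below to p²<j-below-a₂; above to p²≮j-from-a₂)

  private
    T₃ : Threshold (λ x → p x < j) j n
    T₃ = threshold (λ x → p x <? j) (<⇒≤ j<n) (λ j≤x x<y y<n → <-trans (incʳ j≤x x<y y<n))

  open Threshold T₃ using ()
    renaming (point to b₂; lo≤point to j≤b₂; point≤hi to b₂≤n;
              below to p<j-below-b₂; above to p≮j-from-b₂)

  private
    T₄ : Threshold (λ x → p (p x) < j) j b₂
    T₄ = threshold (λ x → p (p x) <? j) j≤b₂ λ j≤x x<y y<b₂ →
      <-trans (incˡ z≤n (incʳ j≤x x<y (<-≤-trans y<b₂ b₂≤n)) (p<j-below-b₂ (≤-trans j≤x (<⇒≤ x<y)) y<b₂))

  open Threshold T₄ using ()
    renaming (point to b₁; lo≤point to j≤b₁; point≤hi to b₁≤b₂;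
              below to p²<j-below-b₁; above to p²≮j-from-b₁)

  A₁↦A₂ : MapsInto p 0 a₁ a₁ a₂
  A₁↦A₂ {x} _ x<a₁ = ≮⇒≥ (orbit-meets-right x<j px<j ∘ p<j-below-a₁ z≤n) , ≰⇒> a₂≰px
    where
    x<j : x < j
    x<j = <-≤-trans x<a₁ a₁≤j
    px<j : p x < j
    px<j = p<j-below-a₁ z≤n x<a₁
    a₂≰px : a₂ ≰ p x
    a₂≰px a₂≤px = <⇒≱ x<j (subst (j ≤_) (p-cube (<-trans x<j j<n)) (≮⇒≥ (p²≮j-from-a₂ a₂≤px px<j)))

  A₂↦B₁ : MapsInto p a₁ a₂ j b₁
  A₂↦B₁ {y} a₁≤y y<a₂ = ≮⇒≥ (p≮j-from-a₁ a₁≤y y<j) , ≰⇒> b₁≰py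
    where
    y<j : y < j
    y<j = <-≤-trans y<a₂ a₂≤j
    py<b₂ : p y < b₂
    py<b₂ = ≰⇒> (λ b₂≤py → p≮j-from-b₂ b₂≤py (p-below (<-trans y<j j<n)) (p²<j-below-a₂ a₁≤y y<a₂))
    b₁≰py : b₁ ≰ p y
    b₁≰py b₁≤py = <⇒≱ y<j (subst (j ≤_) (p-cube (<-trans y<j j<n)) (≮⇒≥ (p²≮j-from-b₁ b₁≤py py<b₂)))

  A₃↦B₃ : MapsInto p a₂ j b₂ n
  A₃↦B₃ {x} a₂≤x x<j =
    ≮⇒≥ (λ px<b₂ → <⇒≱ (p<j-below-b₂ j≤px px<b₂) j≤ppx) , p-below (<-trans x<j j<n)
    where
    j≤px : j ≤ p x
    j≤px = ≮⇒≥ (p≮j-from-a₁ (≤-trans a₁≤a₂ a₂≤x) x<j)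
    j≤ppx : j ≤ p (p x)
    j≤ppx = ≮⇒≥ (p²≮j-from-a₂ a₂≤x x<j)

  B₁↦A₁ : MapsInto p j b₁ 0 a₁
  B₁↦A₁ {z} j≤z z<b₁ = z≤n , ≰⇒> (λ a₁≤pz → p≮j-from-a₁ a₁≤pz pz<j (p²<j-below-b₁ j≤z z<b₁))
    where
    pz<j : p z < j
    pz<j = p<j-below-b₂ j≤z (<-≤-trans z<b₁ b₁≤b₂)

  B₂↦A₃ : MapsInto p b₁ b₂ a₂ j
  B₂↦A₃ {z} b₁≤z z<b₂ = ≮⇒≥ pz≮a₂ , p<j-below-b₂ j≤z z<b₂
    where
    j≤z : j ≤ z
    j≤z = ≤-trans j≤b₁ b₁≤z
    a₁≤pz : a₁ ≤ p z
    a₁≤pz = ≮⇒≥ (λ pz<a₁ → <⇒≱ (p<j-below-a₁ z≤n pz<a₁) (≮⇒≥ (p²≮j-from-b₁ b₁≤z z<b₂)))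
    pz≮a₂ : p z ≮ a₂
    pz≮a₂ pz<a₂ = <⇒≱ (subst (_< j) (p-cube (<-≤-trans z<b₂ b₂≤n)) (p²<j-below-a₂ a₁≤pz pz<a₂)) j≤z

  B₃↦B₂ : MapsInto p b₂ n b₁ b₂
  B₃↦B₂ {y} b₂≤y y<n = ≮⇒≥ py≮b₁ , ≰⇒> b₂≰py
    where
    j≤y : j ≤ y
    j≤y = ≤-trans j≤b₂ b₂≤y
    j≤py : j ≤ p y
    j≤py = ≮⇒≥ (p≮j-from-b₂ b₂≤y y<n)
    b₂≰py : b₂ ≰ p y
    b₂≰py b₂≤py = orbit-meets-left j≤y y<n j≤py (≮⇒≥ (p≮j-from-b₂ b₂≤py (p-below y<n)))
    py≮b₁ : p y ≮ b₁
    py≮b₁ py<b₁ = <⇒≱ (subst (_< j) (p-cube y<n) (p²<j-below-b₁ j≤py py<b₁)) j≤y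

  private
    incA₁ : IncreasingOn p 0 a₁
    incA₁ = increasingOn-mono ≤-refl a₁≤j incˡ
    incA₂ : IncreasingOn p a₁ a₂
    incA₂ = increasingOn-mono z≤n a₂≤j incˡ
    incA₃ : IncreasingOn p a₂ j
    incA₃ = increasingOn-mono z≤n ≤-refl incˡ
    incB₁ : IncreasingOn p j b₁
    incB₁ = increasingOn-mono ≤-refl (≤-trans b₁≤b₂ b₂≤n) incʳ
    incB₂ : IncreasingOn p b₁ b₂
    incB₂ = increasingOn-mono j≤b₁ b₂≤n incʳ
    incB₃ : IncreasingOn p b₂ n
    incB₃ = increasingOn-mono j≤b₂ ≤-refl incʳ

    |A₁|≡|A₂|≡|B₁| : a₁ ≡ a₂ ∸ a₁ × a₂ ∸ a₁ ≡ b₁ ∸ j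
    |A₁|≡|A₂|≡|B₁| = ≤-cycle (increasing-length≤ incA₁ A₁↦A₂) (increasing-length≤ incA₂ A₂↦B₁)
                             (increasing-length≤ incB₁ B₁↦A₁)

    |A₃|≡|B₃|≡|B₂| : j ∸ a₂ ≡ n ∸ b₂ × n ∸ b₂ ≡ b₂ ∸ b₁
    |A₃|≡|B₃|≡|B₂| = ≤-cycle (increasing-length≤ incA₃ A₃↦B₃) (increasing-length≤ incB₃ B₃↦B₂)
                             (increasing-length≤ incB₂ B₂↦A₃)

    s : ℕ
    s = j ∸ a₂
    |B₁|≡r : b₁ ∸ j ≡ a₁
    |B₁|≡r = sym (uncurry trans |A₁|≡|A₂|≡|B₁|)
    |B₂|≡s : b₂ ∸ b₁ ≡ s
    |B₂|≡s = sym (uncurry trans |A₃|≡|B₃|≡|B₂|)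
    a₂≡ : a₂ ≡ a₁ + a₁
    a₂≡ = ∸≡⇒≡+ a₁≤a₂ (sym (proj₁ |A₁|≡|A₂|≡|B₁|))

  is-core : ∃₂ λ r s → coreSize r s ≡ n × Agree n p (core r s)
  is-core = a₁ , s , blocks⇒core a₁ s
    a₂≡ (subst (λ x → j ≡ x + s) a₂≡ (∸≡⇒≡+ a₂≤j refl)) (∸≡⇒≡+ j≤b₁ |B₁|≡r) (∸≡⇒≡+ b₁≤b₂ |B₂|≡s)
    (∸≡⇒≡+ b₂≤n (sym (proj₁ |A₃|≡|B₃|≡|B₂|)))
    (increasing-affine incA₁ A₁↦A₂ (proj₁ |A₁|≡|A₂|≡|B₁|))
    (increasing-affine incA₂ A₂↦B₁ (proj₂ |A₁|≡|A₂|≡|B₁|))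
    (increasing-affine incA₃ A₃↦B₃ (proj₁ |A₃|≡|B₃|≡|B₂|))
    (increasing-affine incB₁ B₁↦A₁ |B₁|≡r)
    (increasing-affine incB₂ B₂↦A₃ |B₂|≡s)
    (increasing-affine incB₃ B₃↦B₂ (proj₂ |A₃|≡|B₃|≡|B₂|))

CanonicalOn : ℕ → (ℕ → ℕ) → Set
CanonicalOn n p = ∃ λ t → Fits n t × Agree n p (canonical t)

module _ {m j p} (good : Good (suc m) j p) where

  open Good good

  private
    p∘suc≡suc∘pred : ∀ {i} → p 0 ≡ 0 → i < m → p (suc i) ≡ suc (pred (p (suc i)))
    p∘suc≡suc∘pred {i} p0≡0 i<m =
      sym (suc-pred (p (suc i)) {{≢-nonZero (1+n≢0 ∘ λ e → p-injective (s≤s i<m) z<s (trans e (sym p0≡0)))}})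

  good-unshift : p 0 ≡ 0 → Good m (pred j) (pred ∘ p ∘ suc)
  good-unshift p0≡0 = record
    { p-below = p′-below
    ; p-cube  = λ {x} x<m → suc-injective (begin
        suc (p′ (p′ (p′ x)))  ≡⟨ p∘suc≡suc∘pred p0≡0 (p′-below (p′-below x<m)) ⟨
        p (suc (p′ (p′ x)))   ≡⟨ cong p (p∘suc≡suc∘pred p0≡0 (p′-below x<m)) ⟨
        p (p (suc (p′ x)))    ≡⟨ cong (p ∘ p) (p∘suc≡suc∘pred p0≡0 x<m) ⟨
        p (p (p (suc x)))     ≡⟨ p-cube (s≤s x<m) ⟩
        suc x                 ∎)
    ; p-asc   = λ {i} i+1<m i+1≢j-1 → ≤-pred
        (subst₂ _<_ (p∘suc≡suc∘pred p0≡0 (<-trans (n<1+n i) i+1<m)) (p∘suc≡suc∘pred p0≡0 i+1<m)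
          (p-asc (s≤s i+1<m) (i+1≢j-1 ∘ cong pred)))
    }
    where
    open ≡-Reasoning
    p′ : ℕ → ℕ
    p′ = pred ∘ p ∘ suc
    p′-below : ∀ {x} → x < m → p′ x < m
    p′-below x<m = ≤-pred (subst (_< suc m) (p∘suc≡suc∘pred p0≡0 x<m) (p-below (s≤s x<m)))

  canonicalOn-unshift : p 0 ≡ 0 → CanonicalOn m (pred ∘ p ∘ suc) → CanonicalOn (suc m) p
  canonicalOn-unshift p0≡0 ((a , r , s) , fits , agree) = (suc a , r , s) , s≤s fits , agree′
    where
    agree′ : Agree (suc m) p (canonical (suc a , r , s))
    agree′ {zero}  _         = p0≡0
    agree′ {suc i} (s≤s i<m) = trans (p∘suc≡suc∘pred p0≡0 i<m) (cong suc (agree i<m))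

  good-restrict : p m ≡ m → Good m j p
  good-restrict pm≡m = record
    { p-below = λ x<m → ≤∧≢⇒< (≤-pred (p-below (m<n⇒m<1+n x<m)))
                  (λ px≡m → <-irrefl (p-injective (m<n⇒m<1+n x<m) ≤-refl (trans px≡m (sym pm≡m))) x<m)
    ; p-cube  = p-cube ∘ m<n⇒m<1+n
    ; p-asc   = p-asc ∘ m<n⇒m<1+n
    }

  canonicalOn-extend : p m ≡ m → CanonicalOn m p → CanonicalOn (suc m) p
  canonicalOn-extend pm≡m (t@(a , r , s) , fits , agree) = t , m≤n⇒m≤1+n fits , agree′
    where
    agree′ : Agree (suc m) p (canonical t)
    agree′ {i} i<m+1 with m≤n⇒m<n∨m≡n (≤-pred i<m+1)
    ... | inj₁ i<m  = agree i<m
    ... | inj₂ refl = trans pm≡m (sym (canonical-fixesFrom a r s fits))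

good⇒canonicalOn : ∀ n {j p} → Good n j p → CanonicalOn n p
good⇒canonicalOn zero    _ = (0 , 0 , 0) , z≤n , λ ()
good⇒canonicalOn (suc m) {p = p} good with p 0 ≟ 0 | p m ≟ m
... | yes p0≡0 | _        = canonicalOn-unshift good p0≡0 (good⇒canonicalOn m (good-unshift good p0≡0))
... | no _     | yes pm≡m = canonicalOn-extend good pm≡m (good⇒canonicalOn m (good-restrict good pm≡m))
... | no p0≢0  | no pm≢m with NoFixedEnds.is-core good p0≢0 pm≢m
...   | r , s , N≡n , agree = (0 , r , s) , ≤-reflexive N≡n , agree

-- Words as functions on ℕ

val : ∀ {k m} → Vec (Fin k) m → ℕ → ℕ
val Vec.[]      i       = 0
val (x Vec.∷ v) zero    = toℕ x
val (x Vec.∷ v) (suc i) = val v i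

val-lookup : ∀ {k m} (v : Vec (Fin k) m) i → toℕ (lookup v i) ≡ val v (toℕ i)
val-lookup (x Vec.∷ v) fzero    = refl
val-lookup (x Vec.∷ v) (fsuc i) = val-lookup v i

val-< : ∀ {k m} (v : Vec (Fin k) m) {i} → i < m → val v i < k
val-< (x Vec.∷ v) {zero}  _         = toℕ<n x
val-< (x Vec.∷ v) {suc i} (s≤s i<m) = val-< v i<m

val-injective : ∀ {k m} (v w : Vec (Fin k) m) → Agree m (val v) (val w) → v ≡ w
val-injective Vec.[]      Vec.[]      _     = refl
val-injective (x Vec.∷ v) (y Vec.∷ w) agree =
  cong₂ Vec._∷_ (toℕ-injective (agree z<s)) (val-injective v w (agree ∘ s≤s))

val-tabulate : ∀ {k m} (g : Fin m → Fin k) {i} (i<m : i < m) → val (tabulate g) i ≡ toℕ (g (fromℕ< i<m))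
val-tabulate g {i} i<m = begin
  val (tabulate g) i                      ≡⟨ cong (val (tabulate g)) (toℕ-fromℕ< i<m) ⟨
  val (tabulate g) (toℕ (fromℕ< i<m))     ≡⟨ val-lookup (tabulate g) (fromℕ< i<m) ⟨
  toℕ (lookup (tabulate g) (fromℕ< i<m))  ≡⟨ cong toℕ (lookup∘tabulate g (fromℕ< i<m)) ⟩
  toℕ (g (fromℕ< i<m))                    ∎
  where open ≡-Reasoning

val-∘ₚ : ∀ {n} (π σ : Word n) {i} → i < n → val (π ∘ₚ σ) i ≡ val π (val σ i)
val-∘ₚ π σ {i} i<n = begin
  val (π ∘ₚ σ) i                          ≡⟨ val-tabulate (λ x → lookup π (lookup σ x)) i<n ⟩
  toℕ (lookup π (lookup σ (fromℕ< i<n)))  ≡⟨ val-lookup π _ ⟩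
  val π (toℕ (lookup σ (fromℕ< i<n)))     ≡⟨ cong (val π) (val-lookup σ _) ⟩
  val π (val σ (toℕ (fromℕ< i<n)))        ≡⟨ cong (val π ∘ val σ) (toℕ-fromℕ< i<n) ⟩
  val π (val σ i)                         ∎
  where open ≡-Reasoning

val-cube : ∀ {n} (π : Word n) {i} → i < n → val (cube π) i ≡ val π (val π (val π i))
val-cube π i<n = trans (val-∘ₚ π (π ∘ₚ π) i<n) (cong (val π) (val-∘ₚ π π i<n))

module _ {A : Set} (f : A → ℕ) (x y : A) (xs : List A) where

  desList-step≡0 : desList f (x ∷ y ∷ xs) ≡ 0 → f x ≤ f y × desList f (y ∷ xs) ≡ 0
  desList-step≡0 with f y <ᵇ f x | <⇒<ᵇ {f y} {f x}
  ... | false | y≮x = λ d≡0 → ≮⇒≥ y≮x , d≡0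
  ... | true  | _   = λ ()

  desList-step<2 : desList f (x ∷ y ∷ xs) < 2 →
                   desList f (y ∷ xs) ≡ 0 ⊎ (f x ≤ f y × desList f (y ∷ xs) < 2)
  desList-step<2 with f y <ᵇ f x | <⇒<ᵇ {f y} {f x}
  ... | false | y≮x = λ d<2 → inj₂ (≮⇒≥ y≮x , d<2)
  ... | true  | _   = λ { (s≤s (s≤s d≤0)) → inj₁ (n≤0⇒n≡0 d≤0) }

  desList-step≤ : f x ≤ f y → desList f (x ∷ y ∷ xs) ≡ desList f (y ∷ xs)
  desList-step≤ x≤y with f y <ᵇ f x | <ᵇ⇒< (f y) (f x)
  ... | false | _   = refl
  ... | true  | y<x = contradiction (y<x _) (≤⇒≯ x≤y)

  desList-step≤1+ : desList f (x ∷ y ∷ xs) ≤ suc (desList f (y ∷ xs))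
  desList-step≤1+ with f y <ᵇ f x
  ... | false = n≤1+n _
  ... | true  = ≤-refl

desᵛ : ∀ {k m} → Vec (Fin k) m → ℕ
desᵛ v = desList toℕ (toList v)

desᵛ≡0⇒ascending : ∀ {k m} (v : Vec (Fin k) m) → desᵛ v ≡ 0 → Ascending (val v) m
desᵛ≡0⇒ascending (x Vec.∷ Vec.[])    _   {zero}  (s≤s ())
desᵛ≡0⇒ascending (x Vec.∷ y Vec.∷ v) d≡0 {zero}  _           = proj₁ (desList-step≡0 toℕ x y (toList v) d≡0)
desᵛ≡0⇒ascending (x Vec.∷ y Vec.∷ v) d≡0 {suc i} (s≤s i+1<m) =
  desᵛ≡0⇒ascending (y Vec.∷ v) (proj₂ (desList-step≡0 toℕ x y (toList v) d≡0)) i+1<m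

ascending⇒desᵛ≡0 : ∀ {k m} (v : Vec (Fin k) m) → Ascending (val v) m → desᵛ v ≡ 0
ascending⇒desᵛ≡0 Vec.[]              _   = refl
ascending⇒desᵛ≡0 (x Vec.∷ Vec.[])    _   = refl
ascending⇒desᵛ≡0 (x Vec.∷ y Vec.∷ v) asc =
  trans (desList-step≤ toℕ x y (toList v) (asc (s≤s z<s))) (ascending⇒desᵛ≡0 (y Vec.∷ v) (asc ∘ s≤s))

desᵛ<2⇒ascendingExcept : ∀ {k m} (v : Vec (Fin k) m) → desᵛ v < 2 → ∃ λ j → AscendingExcept j (val v) m
desᵛ<2⇒ascendingExcept Vec.[]                   _   = 0 , λ ()
desᵛ<2⇒ascendingExcept (x Vec.∷ Vec.[])         _   = 0 , λ { (s≤s ()) }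
desᵛ<2⇒ascendingExcept (x Vec.∷ yv@(y Vec.∷ v)) d<2 =
  [ descentAt1 , (λ asc → extend (desᵛ<2⇒ascendingExcept yv (proj₂ asc)) (proj₁ asc)) ]′
  (desList-step<2 toℕ x y (toList v) d<2)
  where
  descentAt1 : desᵛ yv ≡ 0 → ∃ λ j → AscendingExcept j (val (x Vec.∷ yv)) _
  descentAt1 d≡0 = 1 , λ { {zero} _ 1≢1 → contradiction refl 1≢1
                         ; {suc i} (s≤s i+1<m) _ → desᵛ≡0⇒ascending yv d≡0 i+1<m }
  extend : (∃ λ j → AscendingExcept j (val yv) _) → toℕ x ≤ toℕ y →
           ∃ λ j → AscendingExcept j (val (x Vec.∷ yv)) _
  extend (j , asc) x≤y = suc j , λ { {zero} _ _ → x≤y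
                                   ; {suc i} (s≤s i+1<m) i+2≢j+1 → asc i+1<m (i+2≢j+1 ∘ cong suc) }

ascendingExcept⇒desᵛ<2 : ∀ {k m} j (v : Vec (Fin k) m) → AscendingExcept j (val v) m → desᵛ v < 2
ascendingExcept⇒desᵛ<2 j Vec.[]                   _   = z<s
ascendingExcept⇒desᵛ<2 j (x Vec.∷ Vec.[])         _   = z<s
ascendingExcept⇒desᵛ<2 j (x Vec.∷ yv@(y Vec.∷ v)) asc =
  [ descentAt1
  , (λ j≢1 → subst (_< 2) (sym (desList-step≤ toℕ x y (toList v) (asc (s≤s z<s) (j≢1 ∘ sym))))
                (ascendingExcept⇒desᵛ<2 (pred j) yv (λ i+1<m i+1≢j-1 → asc (s≤s i+1<m) (i+1≢j-1 ∘ cong pred))))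
  ]′ (toSum (j ≟ 1))
  where
  descentAt1 : j ≡ 1 → desᵛ (x Vec.∷ yv) < 2
  descentAt1 refl = s≤s (subst (λ d → desᵛ (x Vec.∷ yv) ≤ suc d)
    (ascending⇒desᵛ≡0 yv (λ i+1<m → asc (s≤s i+1<m) (λ ()))) (desList-step≤1+ toℕ x y (toList v)))

allL-sound : ∀ {A : Set} (p : A → Bool) {xs x} → T (allL p xs) → x ∈ xs → T (p x)
allL-sound p {y ∷ _} all (here refl) = proj₁ (Equivalence.to T-∧ all)
allL-sound p {y ∷ _} all (there x∈)  = allL-sound p (proj₂ (Equivalence.to T-∧ all)) x∈

allL-complete : ∀ {A : Set} (p : A → Bool) xs → (∀ x → T (p x)) → T (allL p xs)
allL-complete p []       _   = tt
allL-complete p (x ∷ xs) all = Equivalence.from T-∧ (all x , allL-complete p xs all)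

private
  T-not∨-elim : ∀ {a b} → T (not a ∨ b) → T a → T b
  T-not∨-elim {true} t _ = t

  T-not∨-intro : ∀ {a b} → (T a → T b) → T (not a ∨ b)
  T-not∨-intro {false} _ = tt
  T-not∨-intro {true}  f = f tt

toList-tabulate : ∀ {A : Set} {n} (f : Fin n → A) → toList (tabulate f) ≡ List.tabulate f
toList-tabulate {n = zero}  f = refl
toList-tabulate {n = suc n} f = cong (f fzero ∷_) (toList-tabulate (f ∘ fsuc))

∈-finList : ∀ {n} (i : Fin n) → i ∈ finList n
∈-finList i = ∈-toList⁺ (∈-allFin⁺ i)

finList-unique : ∀ n → Unique (finList n)
finList-unique n = subst Unique (sym (toList-tabulate id)) (Uniqueₚ.allFin⁺ n)

isPerm⇒injective : ∀ {n} (w : Word n) → T (isPerm w) → InjectiveBelow n (val w)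
isPerm⇒injective {n} w perm {x} {y} x<n y<n wx≡wy = begin
  x                 ≡⟨ toℕ-fromℕ< x<n ⟨
  toℕ (fromℕ< x<n)  ≡⟨ ≡ᵇ⇒≡ _ _ (T-not∨-elim entry (≡⇒≡ᵇ _ _ same-value)) ⟩
  toℕ (fromℕ< y<n)  ≡⟨ toℕ-fromℕ< y<n ⟩
  y                 ∎
  where
  open ≡-Reasoning
  i : Fin n
  i = fromℕ< x<n
  k : Fin n
  k = fromℕ< y<n
  entry : T (not (lookup w i =ᶠ lookup w k) ∨ (i =ᶠ k))
  entry = allL-sound _ (allL-sound _ perm (∈-finList i)) (∈-finList k)
  same-value : toℕ (lookup w i) ≡ toℕ (lookup w k)
  same-value = trans (val-lookup w i) (trans (cong (val w) (toℕ-fromℕ< x<n)) (trans wx≡wy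
                 (sym (trans (val-lookup w k) (cong (val w) (toℕ-fromℕ< y<n))))))

injective⇒isPerm : ∀ {n} (w : Word n) → InjectiveBelow n (val w) → T (isPerm w)
injective⇒isPerm {n} w inj = allL-complete _ (finList n) λ i → allL-complete _ (finList n) λ k →
  T-not∨-intro λ same → ≡⇒≡ᵇ _ _ (inj (toℕ<n i) (toℕ<n k)
    (trans (sym (val-lookup w i)) (trans (≡ᵇ⇒≡ _ _ same) (val-lookup w k))))

concatMap-map≡cartesianProductWith : ∀ {A B C : Set} (f : A → B → C) xs ys →
                                     concatMap (λ x → map (f x) ys) xs ≡ cartesianProductWith f xs ys
concatMap-map≡cartesianProductWith f []       ys = refl
concatMap-map≡cartesianProductWith f (x ∷ xs) ys =
  cong (map (f x) ys ++_) (concatMap-map≡cartesianProductWith f xs ys)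

words-suc : ∀ {A : Set} (xs : List A) m → words xs (suc m) ≡ cartesianProductWith Vec._∷_ xs (words xs m)
words-suc xs m = concatMap-map≡cartesianProductWith Vec._∷_ xs (words xs m)

∈-words : ∀ {A : Set} {xs : List A} → (∀ x → x ∈ xs) → ∀ {m} (v : Vec A m) → v ∈ words xs m
∈-words all Vec.[]                        = here refl
∈-words {xs = xs} all {suc m} (x Vec.∷ v) =
  subst (x Vec.∷ v ∈_) (sym (words-suc xs m)) (∈-cartesianProductWith⁺ Vec._∷_ (all x) (∈-words all v))

words-unique : ∀ {A : Set} {xs : List A} → Unique xs → ∀ m → Unique (words xs m)
words-unique u zero              = All.[] AllPairs.∷ AllPairs.[]
words-unique {xs = xs} u (suc m) =
  subst Unique (sym (words-suc xs m)) (Uniqueₚ.cartesianProductWith⁺ Vec._∷_ ∷-injective u (words-unique u m))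

goodList : (n : ℕ) → List (Word n)
goodList n = filter (T? ∘ good) (perms n)

goodList-unique : ∀ n → Unique (goodList n)
goodList-unique n = Uniqueₚ.filter⁺ (T? ∘ good) (Uniqueₚ.filter⁺ (T? ∘ isPerm) (words-unique (finList-unique n) n))

∈-goodList⁺ : ∀ {n} (π : Word n) → T (isPerm π) → T (good π) → π ∈ goodList n
∈-goodList⁺ π perm gd = ∈-filter⁺ (T? ∘ good) (∈-filter⁺ (T? ∘ isPerm) (∈-words ∈-finList π) perm) gd

∈-goodList⁻ : ∀ {n} {π : Word n} → π ∈ goodList n → T (isPerm π) × T (good π)
∈-goodList⁻ {n} π∈ with ∈-filter⁻ (T? ∘ good) {xs = perms n} π∈
... | π∈perms , gd = proj₂ (∈-filter⁻ (T? ∘ isPerm) {xs = words (finList n) n} π∈perms) , gd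

good⇒des-bounds : ∀ {n} (π : Word n) → T (good π) → des π < 2 × des (cube π) ≡ 0
good⇒des-bounds π gd = <ᵇ⇒< _ 2 (proj₁ (Equivalence.to T-∧ gd)) , ≡ᵇ⇒≡ _ 0 (proj₂ (Equivalence.to T-∧ gd))

perm∧good⇒Good : ∀ {n} (π : Word n) → T (isPerm π) → T (good π) → ∃ λ j → Good n j (val π)
perm∧good⇒Good {n} π perm gd with good⇒des-bounds π gd
... | des<2 , des³≡0 with desᵛ<2⇒ascendingExcept π des<2
...   | j , asc = j , record
  { p-below = val-< π
  ; p-cube  = λ x<n → trans (sym (val-cube π x<n)) (increasing-endo⇒id cube-increasing (val-< (cube π)) x<n)
  ; p-asc   = λ {i} i+1<n i+1≢j → ≤∧≢⇒< (asc i+1<n i+1≢j)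
                (λ πi≡πi+1 → <-irrefl (inj (<-trans (n<1+n i) i+1<n) i+1<n πi≡πi+1) (n<1+n i))
  }
  where
  inj : InjectiveBelow n (val π)
  inj = isPerm⇒injective π perm
  cube-injective : InjectiveBelow n (val (cube π))
  cube-injective x<n y<n eq =
    inj x<n y<n (inj (val-< π x<n) (val-< π y<n) (inj (val-< π (val-< π x<n)) (val-< π (val-< π y<n))
      (trans (sym (val-cube π x<n)) (trans eq (val-cube π y<n)))))
  cube-increasing : IncreasingOn (val (cube π)) 0 n
  cube-increasing = ascending∧injective⇒increasing (desᵛ≡0⇒ascending (cube π) des³≡0) cube-injective

-- Falling back to i is a junk value: it never happens for triples that fit (val-canonicalWord).
clamp : ∀ {n} → Fin n → ℕ → Fin n
clamp {n} i x with x <? n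
... | yes x<n = fromℕ< x<n
... | no _    = i

toℕ-clamp : ∀ {n} (i : Fin n) {x} → x < n → toℕ (clamp i x) ≡ x
toℕ-clamp {n} i {x} x<n with x <? n
... | yes x<n′ = toℕ-fromℕ< x<n′
... | no x≮n   = contradiction x<n x≮n

canonicalWord : ∀ {n} → Triple → Word n
canonicalWord t = tabulate (λ i → clamp i (canonical t (toℕ i)))

val-canonicalWord : ∀ {n} t → Fits n t → Agree n (val (canonicalWord {n} t)) (canonical t)
val-canonicalWord {n} t fits {i} i<n = begin
  val (canonicalWord {n} t) i
    ≡⟨ val-tabulate (λ j → clamp j (canonical t (toℕ j))) i<n ⟩
  toℕ (clamp (fromℕ< i<n) (canonical t (toℕ (fromℕ< i<n))))
    ≡⟨ toℕ-clamp _ (canonical-below t fits (toℕ<n (fromℕ< i<n))) ⟩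
  canonical t (toℕ (fromℕ< i<n))
    ≡⟨ cong (canonical t) (toℕ-fromℕ< i<n) ⟩
  canonical t i
    ∎
  where open ≡-Reasoning

canonicalWord-perm∧good : ∀ {n} t → Fits n t → T (isPerm (canonicalWord {n} t)) × T (good (canonicalWord {n} t))
canonicalWord-perm∧good {n} t@(a , r , s) fits =
  injective⇒isPerm w (λ x<n y<n wx≡wy →
    order3⇒injective {canonical t} (canonical-cube t) (trans (sym (agree x<n)) (trans wx≡wy (agree y<n)))) ,
  Equivalence.from T-∧ (<⇒<ᵇ des<2 , ≡⇒≡ᵇ _ 0 des³≡0)
  where
  w : Word n
  w = canonicalWord t
  agree : Agree n (val w) (canonical t)
  agree = val-canonicalWord t fits
  below : ∀ {u} → u < n → canonical t u < n
  below = canonical-below t fits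
  cube-val : Agree n (val (cube w)) id
  cube-val {i} i<n = begin
    val (cube w) i                             ≡⟨ val-cube w i<n ⟩
    val w (val w (val w i))                    ≡⟨ cong (val w ∘ val w) (agree i<n) ⟩
    val w (val w (canonical t i))              ≡⟨ cong (val w) (agree (below i<n)) ⟩
    val w (canonical t (canonical t i))        ≡⟨ agree (below (below i<n)) ⟩
    canonical t (canonical t (canonical t i))  ≡⟨ canonical-cube t i ⟩
    i                                          ∎
    where open ≡-Reasoning
  des³≡0 : des (cube w) ≡ 0
  des³≡0 = ascending⇒desᵛ≡0 (cube w) (λ {i} i+1<n →
    subst₂ _≤_ (sym (cube-val (<-trans (n<1+n i) i+1<n))) (sym (cube-val i+1<n)) (n≤1+n i))
  des<2 : des w < 2
  des<2 = ascendingExcept⇒desᵛ<2 (a + descentAt r s) w (λ {i} i+1<n i+1≢j →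
    <⇒≤ (subst₂ _<_ (sym (agree (<-trans (n<1+n i) i+1<n))) (sym (agree i+1<n)) (canonical-ascending a r s i+1≢j)))

-- Counting

length-cartesianProductWith : ∀ {A B C : Set} (f : A → B → C) xs ys →
                              length (cartesianProductWith f xs ys) ≡ length xs * length ys
length-cartesianProductWith f []       ys = refl
length-cartesianProductWith f (x ∷ xs) ys = begin
  length (map (f x) ys ++ cartesianProductWith f xs ys)          ≡⟨ length-++ (map (f x) ys) ⟩
  length (map (f x) ys) + length (cartesianProductWith f xs ys)  ≡⟨ cong₂ _+_ (length-map (f x) ys)
                                                                               (length-cartesianProductWith f xs ys) ⟩
  length ys + length xs * length ys                              ∎
  where open ≡-Reasoning

map-unique : ∀ {A B : Set} (f : A → B) {xs} → Unique xs →
             (∀ {x y} → x ∈ xs → y ∈ xs → f x ≡ f y → x ≡ y) → Unique (map f xs)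
map-unique f AllPairs.[]                 _   = AllPairs.[]
map-unique f {x ∷ xs} (x∉xs AllPairs.∷ u) inj =
  All.tabulate fresh AllPairs.∷ map-unique f u (λ x∈ y∈ → inj (there x∈) (there y∈))
  where
  fresh : ∀ {z} → z ∈ map f xs → f x ≢ z
  fresh z∈ fx≡z with ∈-map⁻ f z∈
  ... | y , y∈ , refl = All.lookup x∉xs y∈ (inj (here refl) (there y∈) fx≡z)

triplesOfSize : ℕ → ℕ → List Triple
triplesOfSize n k = cartesianProductWith (λ r a → a , r , k ∸ r) (upTo (suc k)) (upTo (suc (n ∸ 3 * k)))

triples : ℕ → ℕ → List Triple
triples n zero    = []
triples n (suc q) = triplesOfSize n (suc q) ++ triples n q

tripleCount : ℕ → ℕ → ℕ
tripleCount n zero    = 0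
tripleCount n (suc q) = suc (suc q) * suc (n ∸ 3 * suc q) + tripleCount n q

length-triples : ∀ n q → length (triples n q) ≡ tripleCount n q
length-triples n zero    = refl
length-triples n (suc q) = begin
  length (triplesOfSize n (suc q) ++ triples n q)          ≡⟨ length-++ (triplesOfSize n (suc q)) ⟩
  length (triplesOfSize n (suc q)) + length (triples n q)  ≡⟨ cong₂ _+_ size-count (length-triples n q) ⟩
  suc (suc q) * suc (n ∸ 3 * suc q) + tripleCount n q      ∎
  where
  open ≡-Reasoning
  size-count : length (triplesOfSize n (suc q)) ≡ suc (suc q) * suc (n ∸ 3 * suc q)
  size-count = trans
    (length-cartesianProductWith (λ r a → a , r , suc q ∸ r) (upTo (suc (suc q))) (upTo (suc (n ∸ 3 * suc q))))
    (cong₂ _*_ (length-upTo (suc (suc q))) (length-upTo (suc (n ∸ 3 * suc q))))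

Size : Triple → ℕ
Size (_ , r , s) = r + s

∈-triplesOfSize⁺ : ∀ {n a r s} → a + 3 * (r + s) ≤ n → (a , r , s) ∈ triplesOfSize n (r + s)
∈-triplesOfSize⁺ {n} {a} {r} {s} fits = subst (λ x → (a , r , x) ∈ triplesOfSize n (r + s)) (m+n∸m≡n r s)
  (∈-cartesianProductWith⁺ (λ r′ a′ → a′ , r′ , r + s ∸ r′) (∈-upTo⁺ (s≤s (m≤m+n r s)))
    (∈-upTo⁺ (s≤s (subst (_≤ n ∸ 3 * (r + s)) (m+n∸n≡m a (3 * (r + s))) (∸-monoˡ-≤ (3 * (r + s)) fits)))))

∈-triplesOfSize⁻ : ∀ {n k t} → t ∈ triplesOfSize n k → Size t ≡ k × (3 * k ≤ n → proj₁ t + 3 * k ≤ n)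
∈-triplesOfSize⁻ {n} {k} t∈
  with ∈-cartesianProductWith⁻ (λ r a → a , r , k ∸ r) (upTo (suc k)) (upTo (suc (n ∸ 3 * k))) t∈
... | r , a , r∈ , a∈ , refl = m+[n∸m]≡n (≤-pred (∈-upTo⁻ r∈)) ,
  λ 3k≤n → ≤-trans (+-monoˡ-≤ (3 * k) (≤-pred (∈-upTo⁻ a∈))) (≤-reflexive (m∸n+n≡m 3k≤n))

triplesOfSize-unique : ∀ n k → Unique (triplesOfSize n k)
triplesOfSize-unique n k = Uniqueₚ.cartesianProductWith⁺ (λ r a → a , r , k ∸ r)
  (λ eq → cong (proj₁ ∘ proj₂) eq , cong proj₁ eq) (Uniqueₚ.upTo⁺ (suc k)) (Uniqueₚ.upTo⁺ (suc (n ∸ 3 * k)))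

∈-triples⁺ : ∀ {n q a r s} → 0 < r + s → r + s ≤ q → a + 3 * (r + s) ≤ n → (a , r , s) ∈ triples n q
∈-triples⁺ {q = zero} 0<r+s r+s≤0 _ = contradiction 0<r+s (≤⇒≯ r+s≤0)
∈-triples⁺ {n} {suc q} {a} {r} {s} 0<r+s r+s≤q+1 fits with m≤n⇒m<n∨m≡n r+s≤q+1
... | inj₁ (s≤s r+s≤q) = ∈-++⁺ʳ (triplesOfSize n (suc q)) (∈-triples⁺ 0<r+s r+s≤q fits)
... | inj₂ r+s≡q+1     =
  subst (λ k → (a , r , s) ∈ triplesOfSize n k ++ triples n q) r+s≡q+1 (∈-++⁺ˡ (∈-triplesOfSize⁺ fits))

∈-triples⁻ : ∀ {n q t} → t ∈ triples n q → 0 < Size t × Size t ≤ q × (3 * q ≤ n → proj₁ t + 3 * Size t ≤ n)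
∈-triples⁻ {n} {suc q} {t} t∈ with ∈-++⁻ (triplesOfSize n (suc q)) t∈
... | inj₁ t∈ₖ with ∈-triplesOfSize⁻ t∈ₖ
...   | size≡ , fits = subst (0 <_) (sym size≡) z<s , ≤-reflexive size≡ ,
                       subst (λ k → 3 * suc q ≤ n → proj₁ t + 3 * k ≤ n) (sym size≡) fits
∈-triples⁻ {n} {suc q} {t} t∈ | inj₂ t∈ₜ with ∈-triples⁻ t∈ₜ
...   | 0<size , size≤q , fits = 0<size , m≤n⇒m≤1+n size≤q , fits ∘ ≤-trans (*-monoʳ-≤ 3 (n≤1+n q))

triples-unique : ∀ n q → Unique (triples n q)
triples-unique n zero    = AllPairs.[]
triples-unique n (suc q) = Uniqueₚ.++⁺ (triplesOfSize-unique n (suc q)) (triples-unique n q)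
  λ (t∈ₖ , t∈ₜ) → <⇒≢ (s≤s (proj₁ (proj₂ (∈-triples⁻ t∈ₜ)))) (proj₁ (∈-triplesOfSize⁻ {n} t∈ₖ))

triple-fits : ∀ {n q t} → 3 * q ≤ n → t ∈ triples n q → Nontrivial t × Fits n t
triple-fits {n} {q} {a , r , s} 3q≤n t∈ with ∈-triples⁻ {n} {q} t∈
... | 0<r+s , _ , fits = 0<r+s , subst (λ N → a + N ≤ n) (sym (coreSize≡3*[r+s] r s)) (fits 3q≤n)

canonicalWords : (n q : ℕ) → List (Word n)
canonicalWords n q = canonicalWord (0 , 0 , 0) ∷ map canonicalWord (triples n q)

canonicalWords-unique : ∀ {n q} → 3 * q ≤ n → Unique (canonicalWords n q)
canonicalWords-unique {n} {q} 3q≤n =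
  All.tabulate notTrivial AllPairs.∷ map-unique canonicalWord (triples-unique n q) injective
  where
  fits : ∀ {t} → t ∈ triples n q → Nontrivial t × Fits n t
  fits = triple-fits {n} {q} 3q≤n
  agree : ∀ {t} → t ∈ triples n q → Agree n (val (canonicalWord {n} t)) (canonical t)
  agree {t} t∈ = val-canonicalWord t (proj₂ (fits t∈))
  injective : ∀ {t t′} → t ∈ triples n q → t′ ∈ triples n q → canonicalWord t ≡ canonicalWord t′ → t ≡ t′
  injective t∈ t′∈ eq = canonical-injective {n} _ _ (proj₁ (fits t∈)) (proj₁ (fits t′∈))
    (proj₂ (fits t∈)) (proj₂ (fits t′∈))
    (λ i<n → trans (sym (agree t∈ i<n)) (trans (cong (λ w → val w _) eq) (agree t′∈ i<n)))
  notTrivial : ∀ {w} → w ∈ map canonicalWord (triples n q) → canonicalWord (0 , 0 , 0) ≢ w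
  notTrivial w∈ eq with ∈-map⁻ canonicalWord w∈
  ... | (a , r , s) , t∈ , refl = canonical-moves-offset a r s (proj₁ (fits t∈)) (begin
    canonical (a , r , s) a                ≡⟨ agree t∈ a<n ⟨
    val (canonicalWord {n} (a , r , s)) a  ≡⟨ cong (λ w → val w a) eq ⟨
    val (canonicalWord {n} (0 , 0 , 0)) a  ≡⟨ val-canonicalWord (0 , 0 , 0) z≤n a<n ⟩
    canonical (0 , 0 , 0) a                ≡⟨ canonical-trivial 0 {0} {0} refl a ⟩
    a                                      ∎)
    where
    open ≡-Reasoning
    a<n : a < n
    a<n = <-≤-trans (m<m+n a (0<coreSize r s (proj₁ (fits t∈)))) (proj₂ (fits t∈))

goodList⊆canonicalWords : ∀ {n q} → n < 3 * q + 3 → ∀ {π} → π ∈ goodList n → π ∈ canonicalWords n q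
goodList⊆canonicalWords {n} {q} n<3q+3 {π} π∈ with ∈-goodList⁻ π∈
... | perm , gd with perm∧good⇒Good π perm gd
...   | _ , good with good⇒canonicalOn n good
...     | (a , r , s) , fits , agree with r + s ≟ 0
...       | yes r+s≡0 = here (val-injective π (canonicalWord (0 , 0 , 0)) λ {i} i<n → begin
  val π i                                ≡⟨ agree i<n ⟩
  canonical (a , r , s) i                ≡⟨ canonical-trivial a {r} {s} r+s≡0 i ⟩
  i                                      ≡⟨ canonical-trivial 0 {0} {0} refl i ⟨
  canonical (0 , 0 , 0) i                ≡⟨ val-canonicalWord (0 , 0 , 0) z≤n i<n ⟨
  val (canonicalWord {n} (0 , 0 , 0)) i  ∎)
  where open ≡-Reasoning
...       | no r+s≢0 = there (subst (_∈ map canonicalWord (triples n q)) (sym π≡)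
                               (∈-map⁺ canonicalWord (∈-triples⁺ {n} {q} {a} {r} {s} (n≢0⇒n>0 r+s≢0) r+s≤q fits′)))
  where
  fits′ : a + 3 * (r + s) ≤ n
  fits′ = subst (λ N → a + N ≤ n) (coreSize≡3*[r+s] r s) fits
  r+s≤q : r + s ≤ q
  r+s≤q = ≤-pred (*-cancelˡ-< 3 (r + s) (suc q) (begin-strict
    3 * (r + s)      ≤⟨ m≤n+m (3 * (r + s)) a ⟩
    a + 3 * (r + s)  ≤⟨ fits′ ⟩
    n                <⟨ n<3q+3 ⟩
    3 * q + 3        ≡⟨ trans (+-comm (3 * q) 3) (sym (*-suc 3 q)) ⟩
    3 * suc q        ∎))
    where open ≤-Reasoning
  π≡ : π ≡ canonicalWord (a , r , s)
  π≡ = val-injective π (canonicalWord (a , r , s)) λ i<n →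
    trans (agree i<n) (sym (val-canonicalWord (a , r , s) fits i<n))

canonicalWords⊆goodList : ∀ {n q} → 3 * q ≤ n → ∀ {w} → w ∈ canonicalWords n q → w ∈ goodList n
canonicalWords⊆goodList {n} {q} 3q≤n (here refl) =
  uncurry (∈-goodList⁺ _) (canonicalWord-perm∧good {n} (0 , 0 , 0) z≤n)
canonicalWords⊆goodList {n} {q} 3q≤n (there w∈) with ∈-map⁻ canonicalWord w∈
... | t , t∈ , refl = uncurry (∈-goodList⁺ _) (canonicalWord-perm∧good t (proj₂ (triple-fits {n} {q} 3q≤n t∈)))

count≡suc-tripleCount : ∀ {n q} → 3 * q ≤ n → n < 3 * q + 3 → count n ≡ suc (tripleCount n q)
count≡suc-tripleCount {n} {q} 3q≤n n<3q+3 = begin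
  length (goodList n)          ≡⟨ ↭-length goodList↭canonicalWords ⟩
  length (canonicalWords n q)  ≡⟨ cong suc (length-map canonicalWord (triples n q)) ⟩
  suc (length (triples n q))   ≡⟨ cong suc (length-triples n q) ⟩
  suc (tripleCount n q)        ∎
  where
  open ≡-Reasoning
  goodList↭canonicalWords : goodList n ↭ canonicalWords n q
  goodList↭canonicalWords = ∼bag⇒↭ (unique∧set⇒bag (goodList-unique n) (canonicalWords-unique {n} {q} 3q≤n)
    (mk⇔ (goodList⊆canonicalWords {n} {q} n<3q+3) (canonicalWords⊆goodList {n} {q} 3q≤n)))

-- Closed forms

private
  tripleCount-step : ∀ X q c →
    2 * X + 2 * (q * (q + 1) * (q + 2)) ≡ q * (q + 3) * suc (3 * suc q + c) →
    2 * (suc (suc q) * suc c + X) + 2 * (suc q * (suc q + 1) * (suc q + 2)) ≡ suc q * (suc q + 3) * suc (3 * suc q + c)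
  tripleCount-step X q c ih = +-cancelʳ-≡ (2 * (q * (q + 1) * (q + 2))) _ _ (begin
    2 * (suc (suc q) * suc c + X) + 2 * (suc q * (suc q + 1) * (suc q + 2)) + 2 * (q * (q + 1) * (q + 2))
      ≡⟨ solve (X ∷ q ∷ c ∷ []) ⟩
    2 * X + 2 * (q * (q + 1) * (q + 2)) + 2 * (suc (suc q) * suc c + suc q * (suc q + 1) * (suc q + 2))
      ≡⟨ cong (_+ 2 * (suc (suc q) * suc c + suc q * (suc q + 1) * (suc q + 2))) ih ⟩
    q * (q + 3) * suc (3 * suc q + c) + 2 * (suc (suc q) * suc c + suc q * (suc q + 1) * (suc q + 2))
      ≡⟨ solve (q ∷ c ∷ []) ⟩
    suc q * (suc q + 3) * suc (3 * suc q + c) + 2 * (q * (q + 1) * (q + 2)) ∎)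
    where open ≡-Reasoning

tripleCount-closed : ∀ n q → 3 * q ≤ n → 2 * tripleCount n q + 2 * (q * (q + 1) * (q + 2)) ≡ q * (q + 3) * suc n
tripleCount-closed n zero    _      = refl
tripleCount-closed n (suc q) 3q+3≤n with m≤n⇒∃[o]m+o≡n 3q+3≤n
... | c , refl =
  subst (λ d → 2 * (suc (suc q) * suc d + tripleCount n q) + 2 * (suc q * (suc q + 1) * (suc q + 2))
               ≡ suc q * (suc q + 3) * suc n)
        (sym (m+n∸m≡n (3 * suc q) c))
        (tripleCount-step (tripleCount n q) q c (tripleCount-closed n q (≤-trans (*-monoʳ-≤ 3 (n≤1+n q)) 3q+3≤n)))

count-closed : ∀ n q → 3 * q ≤ n → n < 3 * q + 3 →
               2 * count n + 2 * (q * (q + 1) * (q + 2)) ≡ q * (q + 3) * suc n + 2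
count-closed n q 3q≤n n<3q+3 = begin
  2 * count n + 2 * (q * (q + 1) * (q + 2))                ≡⟨ cong (λ c → 2 * c + 2 * (q * (q + 1) * (q + 2)))
                                                                   (count≡suc-tripleCount {n} {q} 3q≤n n<3q+3) ⟩
  2 * suc (tripleCount n q) + 2 * (q * (q + 1) * (q + 2))  ≡⟨ regroup (tripleCount n q) (q * (q + 1) * (q + 2)) ⟩
  2 * tripleCount n q + 2 * (q * (q + 1) * (q + 2)) + 2    ≡⟨ cong (_+ 2) (tripleCount-closed n q 3q≤n) ⟩
  q * (q + 3) * suc n + 2                                  ∎
  where
  open ≡-Reasoning
  regroup : ∀ X Y → 2 * suc X + 2 * Y ≡ 2 * X + 2 * Y + 2
  regroup = solve-∀

-- k ^ 3 and k ^ 2 unfold to k * (k * (k * 1)) and k * (k * 1), the form the ring solver accepts.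
private
  module _ {c k : ℕ} where
    cubic₀ : 2 * c + 2 * (k * (k + 1) * (k + 2)) ≡ k * (k + 3) * suc (3 * k) + 2 →
             2 * c + k ≡ k * (k * (k * 1)) + 4 * (k * (k * 1)) + 2
    cubic₀ closed = +-cancelʳ-≡ (2 * (k * (k + 1) * (k + 2))) _ _ (begin
      2 * c + k + 2 * (k * (k + 1) * (k + 2))  ≡⟨ solve (c ∷ k ∷ []) ⟩
      2 * c + 2 * (k * (k + 1) * (k + 2)) + k  ≡⟨ cong (_+ k) closed ⟩
      k * (k + 3) * suc (3 * k) + 2 + k        ≡⟨ solve (k ∷ []) ⟩
      k * (k * (k * 1)) + 4 * (k * (k * 1)) + 2 + 2 * (k * (k + 1) * (k + 2)) ∎)
      where open ≡-Reasoning

    cubic₁ : 2 * c + 2 * (k * (k + 1) * (k + 2)) ≡ k * (k + 3) * suc (3 * k + 1) + 2 →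
             2 * c ≡ k * (k * (k * 1)) + 5 * (k * (k * 1)) + 2 * k + 2
    cubic₁ closed = +-cancelʳ-≡ (2 * (k * (k + 1) * (k + 2))) _ _ (trans closed (solve (k ∷ [])))

    cubic₂ : 2 * c + 2 * (k * (k + 1) * (k + 2)) ≡ k * (k + 3) * suc (3 * k + 2) + 2 →
             2 * c ≡ k * (k * (k * 1)) + 6 * (k * (k * 1)) + 5 * k + 2
    cubic₂ closed = +-cancelʳ-≡ (2 * (k * (k + 1) * (k + 2))) _ _ (trans closed (solve (k ∷ [])))

count-3k : ∀ k → 2 * count (3 * k) + k ≡ k ^ 3 + 4 * k ^ 2 + 2
count-3k k = cubic₀ {count (3 * k)} {k} (count-closed (3 * k) k ≤-refl (m<m+n (3 * k) z<s))

count-3k+1 : ∀ k → 2 * count (3 * k + 1) ≡ k ^ 3 + 5 * k ^ 2 + 2 * k + 2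
count-3k+1 k = cubic₁ {count (3 * k + 1)} {k}
  (count-closed (3 * k + 1) k (m≤m+n (3 * k) 1) (+-monoʳ-< (3 * k) (s≤s (s≤s z≤n))))

count-3k+2 : ∀ k → 2 * count (3 * k + 2) ≡ k ^ 3 + 6 * k ^ 2 + 5 * k + 2
count-3k+2 k = cubic₂ {count (3 * k + 2)} {k}
  (count-closed (3 * k + 2) k (m≤m+n (3 * k) 2) (+-monoʳ-< (3 * k) (s≤s (s≤s (s≤s z≤n)))))

2*C[m+2,2] : ∀ m → 2 * ((m + 2) C 2) ≡ (m + 1) * (m + 2)
2*C[m+2,2] zero    = refl
2*C[m+2,2] (suc m) = begin
  2 * (suc (m + 2) C 2)            ≡⟨ cong (2 *_) (nCk+nC[k+1]≡[n+1]C[k+1] (m + 2) 1) ⟨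
  2 * ((m + 2) C 1 + (m + 2) C 2)  ≡⟨ cong (λ x → 2 * (x + (m + 2) C 2)) (nC1≡n (m + 2)) ⟩
  2 * (m + 2 + (m + 2) C 2)        ≡⟨ *-distribˡ-+ 2 (m + 2) ((m + 2) C 2) ⟩
  2 * (m + 2) + 2 * ((m + 2) C 2)  ≡⟨ cong (2 * (m + 2) +_) (2*C[m+2,2] m) ⟩
  2 * (m + 2) + (m + 1) * (m + 2)  ≡⟨ solve (m ∷ []) ⟩
  (suc m + 1) * (suc m + 2)        ∎
  where open ≡-Reasoning

6*C[m+3,3] : ∀ m → 6 * ((m + 3) C 3) ≡ (m + 1) * (m + 2) * (m + 3)
6*C[m+3,3] zero    = refl
6*C[m+3,3] (suc m) = begin
  6 * (suc (m + 3) C 3)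
    ≡⟨ cong (6 *_) (nCk+nC[k+1]≡[n+1]C[k+1] (m + 3) 2) ⟨
  6 * ((m + 3) C 2 + (m + 3) C 3)
    ≡⟨ *-distribˡ-+ 6 ((m + 3) C 2) ((m + 3) C 3) ⟩
  6 * ((m + 3) C 2) + 6 * ((m + 3) C 3)
    ≡⟨ cong₂ _+_ (*-assoc 3 2 ((m + 3) C 2)) (6*C[m+3,3] m) ⟩
  3 * (2 * ((m + 3) C 2)) + (m + 1) * (m + 2) * (m + 3)
    ≡⟨ cong (λ x → 3 * (2 * (x C 2)) + (m + 1) * (m + 2) * (m + 3)) (+-suc m 2) ⟩
  3 * (2 * ((suc m + 2) C 2)) + (m + 1) * (m + 2) * (m + 3)
    ≡⟨ cong (λ x → 3 * x + (m + 1) * (m + 2) * (m + 3)) (2*C[m+2,2] (suc m)) ⟩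
  3 * ((suc m + 1) * (suc m + 2)) + (m + 1) * (m + 2) * (m + 3)
    ≡⟨ solve (m ∷ []) ⟩
  (suc m + 1) * (suc m + 2) * (suc m + 3)
    ∎
  where open ≡-Reasoning

[3q+e]/3≡q : ∀ {m} q e → e < 3 → m ≡ 3 * q + e → m / 3 ≡ q
[3q+e]/3≡q q e e<3 refl = begin
  (3 * q + e) / 3    ≡⟨ +-distrib-/-∣ˡ e (m∣m*n q) ⟩
  3 * q / 3 + e / 3  ≡⟨ cong₂ _+_ (trans (/-congˡ (*-comm 3 q)) (m*n/n≡m q 3)) (m<n⇒m/n≡0 e<3) ⟩
  q + 0              ≡⟨ +-identityʳ q ⟩
  q                  ∎
  where open ≡-Reasoning

data Residue3 : ℕ → Set where
  3q   : ∀ q → Residue3 (3 * q)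
  3q+1 : ∀ q → Residue3 (3 * q + 1)
  3q+2 : ∀ q → Residue3 (3 * q + 2)

private
  3q+1≡ : ∀ q → 3 * q + 1 ≡ suc (3 * q)
  3q+1≡ q = +-comm (3 * q) 1
  3q+2≡ : ∀ q → 3 * q + 2 ≡ suc (3 * q + 1)
  3q+2≡ = solve-∀
  3[q+1]≡ : ∀ q → 3 * suc q ≡ suc (3 * q + 2)
  3[q+1]≡ = solve-∀
  3[q+1]≡2+ : ∀ q → 3 * suc q ≡ 2 + (3 * q + 1)
  3[q+1]≡2+ = solve-∀
  3[q+1]+1≡2+ : ∀ q → 3 * suc q + 1 ≡ 2 + (3 * q + 2)
  3[q+1]+1≡2+ = solve-∀

residue3 : ∀ n → Residue3 n
residue3 zero = 3q 0
residue3 (suc n) with residue3 n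
... | 3q q   = subst Residue3 (3q+1≡ q) (3q+1 q)
... | 3q+1 q = subst Residue3 (3q+2≡ q) (3q+2 q)
... | 3q+2 q = subst Residue3 (3[q+1]≡ q) (3q (suc q))

private
  6*[C+C+C] : ∀ x y z → 6 * ((x + 3) C 3 + (y + 3) C 3 + (z + 3) C 3) ≡
              (x + 1) * (x + 2) * (x + 3) + (y + 1) * (y + 2) * (y + 3) + (z + 1) * (z + 2) * (z + 3)
  6*[C+C+C] x y z = begin
    6 * ((x + 3) C 3 + (y + 3) C 3 + (z + 3) C 3)
      ≡⟨ *-distribˡ-+ 6 ((x + 3) C 3 + (y + 3) C 3) ((z + 3) C 3) ⟩
    6 * ((x + 3) C 3 + (y + 3) C 3) + 6 * ((z + 3) C 3)
      ≡⟨ cong (_+ 6 * ((z + 3) C 3)) (*-distribˡ-+ 6 ((x + 3) C 3) ((y + 3) C 3)) ⟩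
    6 * ((x + 3) C 3) + 6 * ((y + 3) C 3) + 6 * ((z + 3) C 3)
      ≡⟨ cong₂ _+_ (cong₂ _+_ (6*C[m+3,3] x) (6*C[m+3,3] y)) (6*C[m+3,3] z) ⟩
    (x + 1) * (x + 2) * (x + 3) + (y + 1) * (y + 2) * (y + 3) + (z + 1) * (z + 2) * (z + 3)
      ∎
    where open ≡-Reasoning

  from-floors : ∀ {n q x y z} → n / 3 ≡ x → (n ∸ 1) / 3 ≡ y → (n ∸ 2) / 3 ≡ z →
    2 * count n + 2 * (q * (q + 1) * (q + 2)) ≡ q * (q + 3) * suc n + 2 →
    (x + 1) * (x + 2) * (x + 3) + (y + 1) * (y + 2) * (y + 3) + (z + 1) * (z + 2) * (z + 3)
      + 6 * (q * (q + 1) * (q + 2)) ≡ 3 * (q * (q + 3) * suc n + 2) + 6 * n →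
    count n + n ≡ (n / 3 + 3) C 3 + ((n ∸ 1) / 3 + 3) C 3 + ((n ∸ 2) / 3 + 3) C 3
  from-floors {n} {q} {x} {y} {z} refl refl refl closed polynomial =
    *-cancelˡ-≡ _ _ 6 (+-cancelʳ-≡ (6 * (q * (q + 1) * (q + 2))) _ _ (begin
      6 * (count n + n) + 6 * (q * (q + 1) * (q + 2))          ≡⟨ regroup (count n) n q ⟩
      3 * (2 * count n + 2 * (q * (q + 1) * (q + 2))) + 6 * n  ≡⟨ cong (λ v → 3 * v + 6 * n) closed ⟩
      3 * (q * (q + 3) * suc n + 2) + 6 * n                    ≡⟨ polynomial ⟨
      (x + 1) * (x + 2) * (x + 3) + (y + 1) * (y + 2) * (y + 3) + (z + 1) * (z + 2) * (z + 3)
        + 6 * (q * (q + 1) * (q + 2))                          ≡⟨ cong (_+ 6 * (q * (q + 1) * (q + 2))) (6*[C+C+C] x y z) ⟨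
      6 * ((x + 3) C 3 + (y + 3) C 3 + (z + 3) C 3) + 6 * (q * (q + 1) * (q + 2)) ∎))
    where
    open ≡-Reasoning
    regroup : ∀ c n q → 6 * (c + n) + 6 * (q * (q + 1) * (q + 2)) ≡ 3 * (2 * c + 2 * (q * (q + 1) * (q + 2))) + 6 * n
    regroup = solve-∀

count+n≡binomials : ∀ n → 2 ≤ n → count n + n ≡ (n / 3 + 3) C 3 + ((n ∸ 1) / 3 + 3) C 3 + ((n ∸ 2) / 3 + 3) C 3
count+n≡binomials n 2≤n with residue3 n
... | 3q zero      = contradiction 2≤n λ ()
... | 3q (suc q)   = from-floors {3 * suc q} {suc q} {suc q} {q} {q}
  ([3q+e]/3≡q (suc q) 0 z<s (sym (+-identityʳ _)))
  ([3q+e]/3≡q q 2 (s≤s (s≤s (s≤s z≤n))) (cong (_∸ 1) (3[q+1]≡ q)))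
  ([3q+e]/3≡q q 1 (s≤s (s≤s z≤n)) (cong (_∸ 2) (3[q+1]≡2+ q)))
  (count-closed (3 * suc q) (suc q) ≤-refl (m<m+n (3 * suc q) z<s))
  (solve (q ∷ []))
... | 3q+1 zero    = contradiction 2≤n λ { (s≤s ()) }
... | 3q+1 (suc q) = from-floors {3 * suc q + 1} {suc q} {suc q} {suc q} {q}
  ([3q+e]/3≡q (suc q) 1 (s≤s (s≤s z≤n)) refl)
  ([3q+e]/3≡q (suc q) 0 z<s (trans (cong (_∸ 1) (3q+1≡ (suc q))) (sym (+-identityʳ _))))
  ([3q+e]/3≡q q 2 (s≤s (s≤s (s≤s z≤n))) (cong (_∸ 2) (3[q+1]+1≡2+ q)))
  (count-closed (3 * suc q + 1) (suc q) (m≤m+n (3 * suc q) 1) (+-monoʳ-< (3 * suc q) (s≤s (s≤s z≤n))))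
  (solve (q ∷ []))
... | 3q+2 q       = from-floors {3 * q + 2} {q} {q} {q} {q}
  ([3q+e]/3≡q q 2 (s≤s (s≤s (s≤s z≤n))) refl)
  ([3q+e]/3≡q q 1 (s≤s (s≤s z≤n)) (cong (_∸ 1) (3q+2≡ q)))
  ([3q+e]/3≡q q 0 z<s (trans (cong (_∸ 2) (+-comm (3 * q) 2)) (sym (+-identityʳ _))))
  (count-closed (3 * q + 2) q (m≤m+n (3 * q) 2) (+-monoʳ-< (3 * q) (s≤s (s≤s (s≤s z≤n)))))
  (solve (q ∷ []))

theorem3p1 : (n : ℕ) → 2 ≤ n →
    (count n + n ≡ ((n / 3 + 3) C 3) + (((n ∸ 1) / 3 + 3) C 3) + (((n ∸ 2) / 3 + 3) C 3))
    × ((k : ℕ) → n ≡ 3 * k → 2 * count n + k ≡ k ^ 3 + 4 * k ^ 2 + 2)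
    × ((k : ℕ) → n ≡ 3 * k + 1 → 2 * count n ≡ k ^ 3 + 5 * k ^ 2 + 2 * k + 2)
    × ((k : ℕ) → n ≡ 3 * k + 2 → 2 * count n ≡ k ^ 3 + 6 * k ^ 2 + 5 * k + 2)
theorem3p1 n 2≤n =
  count+n≡binomials n 2≤n ,
  (λ { k refl → count-3k k }) ,
  (λ { k refl → count-3k+1 k }) ,
  (λ { k refl → count-3k+2 k })
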